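{- Let $B=\{b_1,b_2,b_3\}$ be a set of three integers with $\nu(b_1)=\nu(b_2)=\nu(b_3)=0$ and $r(b_1)=r(b_2)=r(b_3)$. Set $x=b_1-b_3$ and $y=b_2-b_3$. (i) If $\nu(x)\ne\nu(y)$ then there is a multiplier $\lambda$ such that $\ell(\lambda\cdot B)\le 2$. (ii) If $\nu(x)=\nu(y)=h<m$ and $r(y)=jr(x)$ with $j\in\{2,3\}$, then there is a multiplier $\lambda$ such that $q(\lambda y)\in\{0,5,6\}$ and $\ell(\lambda\cdot B)\le j$. Moreover, if $j=3$, then $\lambda\in\Lambda_h$.
   Context: Fix an integer $m\ge 2$ and $N=7^{m+1}$. For a nonzero integer $x$, $\nu(x)$ is the largest $k$ with $7^k\mid x$, and $r(x)$ is the residue modulo $7$ of $x/7^{\nu(x)}$ (relations such as $r(y)=jr(x)$ are modulo 7). For an integer $x$ (or element of $\mathbb{Z}_N$), $q(x)\in\mathbb{Z}_7$ is the residue modulo $7$ of $\lfloor x/7^m\rfloor$. A multiplier is an invertible element of $\mathbb{Z}_N$; $\lambda\cdot B=\{\lambda b:b\in B\}$. For $0\le h\le m-1$, $\Lambda_h=\{1+7^{m-h}k:0\le k\le6\}$. For $Y\subset\mathbb{Z}_7$, $\ell(Y)$ is the least $L\ge0$ with $Y\subseteq\{a,\dots,a+L-1\}$ (mod 7) for some $a$; for a set $X$ of integers or elements of $\mathbb{Z}_N$, $\ell(X)=\ell(q(X))$. -}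

module Defs where

open import Data.Nat as ℕ using (ℕ; zero; suc; _+_; _*_; _^_; _<_; _∸_; NonZero)
open import Data.Nat.Properties using (m^n≢0)
open import Data.Integer as ℤ using (ℤ; +_; ∣_∣; _/ℕ_; _%ℕ_)
open import Data.List using (List; upTo)
open import Data.Bool.ListAction using (all; any)
open import Data.Bool using (Bool; if_then_else_)
open import Data.Product using (Σ; ∃; _×_)
open import Relation.Binary.PropositionalEquality using (_≡_)
open import Relation.Nullary.Decidable using (⌊_⌋)


N : ℕ → ℕ
N m = 7 ^ suc m

-- 7-adic valuation ν and leading residue r (for nonzero integers).
-- νℕ n = largest k with 7^k ∣ n, for n > 0, computed by repeated division
-- (fuel n suffices since every step divides by 7).  νℕ 0 = 0 (junk value;
-- the paper only applies ν to nonzero integers).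

νℕ-go : ℕ → ℕ → ℕ
νℕ-go zero n = 0
νℕ-go (suc f) n with n ℕ.% 7
... | zero  = suc (νℕ-go f (n ℕ./ 7))
... | suc _ = 0

νℕ : ℕ → ℕ
νℕ n = νℕ-go n n

ν : ℤ → ℕ
ν x = νℕ ∣ x ∣

r : ℤ → ℕ
r x = ((_/ℕ_ x (7 ^ ν x) {{m^n≢0 7 (ν x)}})) %ℕ 7

-- Z_N, represented by ℕ-representatives in [0, N).

modN : ℕ → ℤ → ℕ
modN m x = _%ℕ_ x (N m) {{m^n≢0 7 (suc m)}}

q : ℕ → ℕ → ℕ
q m x = (ℕ._/_ x (7 ^ m) {{m^n≢0 7 m}}) ℕ.% 7

Multiplier : ℕ → ℕ → Set
Multiplier m λ' = λ' < N m × ∃ λ μ → ℕ._%_ (λ' * μ) (N m) {{m^n≢0 7 (suc m)}} ≡ 1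

_·[_]_ : ℕ → ℕ → ℤ → ℕ
λ' ·[ m ] b = modN m (+ λ' ℤ.* b)

Λ : ℕ → ℕ → ℕ → Set
Λ m h λ' = Σ ℕ λ k → k < 7 × λ' ≡ 1 + 7 ^ (m ∸ h) * k

-- ℓ(Y) for Y ⊆ Z_7 (given as a list of residues in 0..6):
-- the least L ≥ 0 such that Y ⊆ {a, …, a+L-1} (mod 7) for some a.

fitsAt : ℕ → ℕ → List ℕ → Bool
fitsAt L a ys = all (λ y → ⌊ ((y + 7 ∸ a) ℕ.% 7) ℕ.<? L ⌋) ys

fits : ℕ → List ℕ → Bool
fits L ys = any (λ a → fitsAt L a ys) (upTo 7)

-- search L = L₀, L₀+1, … (L = 7 always fits)
ℓ-from : ℕ → ℕ → List ℕ → ℕ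
ℓ-from zero    L ys = L
ℓ-from (suc k) L ys = if fits L ys then L else ℓ-from k (suc L) ys

ℓ : List ℕ → ℕ
ℓ ys = ℓ-from 7 0 ys

-- ℓ(λ · B) = ℓ(q(λ · B)) for a finite set B of integers given as a list
open import Data.List using (map)

ℓ· : ℕ → ℕ → List ℤ → ℕ
ℓ· m λ' B = ℓ (map (λ b → q m (λ' ·[ m ] b)) B)

module Submission where

-- Everything is computed in ℤ_N, N = 7^(m+1), where q reads the leading
-- base-7 digit (place value P = 7^m).  With x = b₁ − b₃ and y = b₂ − b₃ we have
-- λbᵢ = λb₃ + λxᵢ, so q(λbᵢ) = q(λb₃) + q(λxᵢ) + carry with carry ∈ {0,1}
-- (Digits, Shape): the window of λ·B is governed by the leading digits of λx,
-- λy and the order of their low parts, and windows in ℤ₇ are settled by finite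
-- computation (BoundedSearch, Windows).  A nonzero x is U·7^ν(x) in ℤ_N with U
-- a unit congruent to r(x) (IntegerReduction, Valuation), and units are
-- invertible modulo every power of 7 (Units).
--   (i)  ν(x) ≠ ν(y): some multiplier sends x and y to residues ≤ P (PartOne).
--   (ii) ν(x) = ν(y) = h < m (Levels): for j = 2 normalise x by u_x⁻¹ and choose
--        λ by an approximation argument (Approximation, CaseTwo); for j = 3 a
--        finite search over λ ∈ Λ_h succeeds (CaseThree).

open import Data.Nat using (ℕ; NonZero; _<_; _≤_)
open import Data.Integer using (ℤ)
open import Relation.Binary.PropositionalEquality using (_≢_)

module Congruence (d : ℕ) {{_ : NonZero d}} where
  open import Data.Nat using (_+_; _*_; _%_)
  open import Data.Nat.DivMod using (%-distribˡ-+; %-distribˡ-*; m%n%n≡m%n; [m+kn]%n≡m%n)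
  open import Relation.Binary.Bundles using (Setoid)
  open import Relation.Binary.PropositionalEquality using (_≡_; refl; sym; trans; cong₂; module ≡-Reasoning)
  import Relation.Binary.Reasoning.Setoid as SetoidReasoning

  infix 4 _≈_
  _≈_ : ℕ → ℕ → Set
  a ≈ b = a % d ≡ b % d

  ≈-setoid : Setoid _ _
  ≈-setoid = record { Carrier = ℕ ; _≈_ = _≈_
                    ; isEquivalence = record { refl = refl ; sym = sym ; trans = trans } }

  module ≈-Reasoning = SetoidReasoning ≈-setoid

  ≈-+ : ∀ {a b c e} → a ≈ b → c ≈ e → a + c ≈ b + e
  ≈-+ {a} {b} {c} {e} p q = begin
    (a + c) % d           ≡⟨ %-distribˡ-+ a c d ⟩
    (a % d + c % d) % d   ≡⟨ cong₂ (λ u v → (u + v) % d) p q ⟩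
    (b % d + e % d) % d   ≡⟨ %-distribˡ-+ b e d ⟨
    (b + e) % d           ∎
    where open ≡-Reasoning

  ≈-* : ∀ {a b c e} → a ≈ b → c ≈ e → a * c ≈ b * e
  ≈-* {a} {b} {c} {e} p q = begin
    (a * c) % d               ≡⟨ %-distribˡ-* a c d ⟩
    (a % d * (c % d)) % d     ≡⟨ cong₂ (λ u v → (u * v) % d) p q ⟩
    (b % d * (e % d)) % d     ≡⟨ %-distribˡ-* b e d ⟨
    (b * e) % d               ∎
    where open ≡-Reasoning

  ≈-+ˡ : ∀ c {a b} → a ≈ b → c + a ≈ c + b
  ≈-+ˡ c = ≈-+ {c} {c} refl

  ≈-+ʳ : ∀ c {a b} → a ≈ b → a + c ≈ b + c
  ≈-+ʳ c p = ≈-+ p (refl {x = c % d})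

  ≈-*ˡ : ∀ c {a b} → a ≈ b → c * a ≈ c * b
  ≈-*ˡ c = ≈-* {c} {c} refl

  ≈-*ʳ : ∀ c {a b} → a ≈ b → a * c ≈ b * c
  ≈-*ʳ c p = ≈-* p (refl {x = c % d})

  %-≈ : ∀ a → a % d ≈ a
  %-≈ a = m%n%n≡m%n a d

  +-multiple-≈ : ∀ a k → a + k * d ≈ a
  +-multiple-≈ a k = [m+kn]%n≡m%n a k d

  %-+ˡ : ∀ a b → a % d + b ≈ a + b
  %-+ˡ a b = ≈-+ʳ b {a % d} {a} (%-≈ a)

  %-+ʳ : ∀ a b → a + b % d ≈ a + b
  %-+ʳ a b = ≈-+ˡ a {b % d} {b} (%-≈ b)

  %-*ʳ : ∀ a b → a * (b % d) ≈ a * b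
  %-*ʳ a b = ≈-*ˡ a {b % d} {b} (%-≈ b)

  %-+-% : ∀ a b → a % d + b % d ≈ a + b
  %-+-% a b = ≈-+ {a % d} {a} {b % d} {b} (%-≈ a) (%-≈ b)

-- Bounded quantifiers over {0, …, n-1} as boolean computations.  Finite
-- facts are established by letting the type checker evaluate them to true.
module BoundedSearch where
  open import Data.Nat using (ℕ; zero; suc; _<_)
  open import Data.Nat.Properties using (m≤n⇒m<n∨m≡n; ≤-pred; m<n⇒m<1+n; n<1+n)
  open import Data.Bool using (Bool; true; false; _∧_; _∨_; T)
  open import Data.Bool.Properties using (T-∧; T-∨)
  open import Data.Product using (Σ; _×_; _,_; proj₁; proj₂)
  open import Data.Sum using (inj₁; inj₂)
  open import Function.Bundles using (Equivalence)
  open import Relation.Binary.PropositionalEquality using (refl)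

  All< : ℕ → (ℕ → Bool) → Bool
  All< zero    f = true
  All< (suc n) f = f n ∧ All< n f

  Any< : ℕ → (ℕ → Bool) → Bool
  Any< zero    f = false
  Any< (suc n) f = f n ∨ Any< n f

  All<-sound : ∀ n f {k} → T (All< n f) → k < n → T (f k)
  All<-sound (suc n) f {k} t k<1+n with m≤n⇒m<n∨m≡n (≤-pred k<1+n)
  ... | inj₁ k<n  = All<-sound n f (proj₂ (Equivalence.to T-∧ t)) k<n
  ... | inj₂ refl = proj₁ (Equivalence.to T-∧ t)

  Any<-sound : ∀ n f → T (Any< n f) → Σ ℕ (λ k → k < n × T (f k))
  Any<-sound (suc n) f t with Equivalence.to (T-∨ {f n}) t
  ... | inj₁ fn = n , n<1+n n , fn
  ... | inj₂ rest with Any<-sound n f rest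
  ...   | k , k<n , fk = k , m<n⇒m<1+n k<n , fk

-- Units modulo powers of 7: products of units are units (7 is prime), and a
-- residue that is a unit mod 7 is invertible mod every 7^(e+1)
-- (invert mod 7 by search, then lift by μ ↦ μ(1 + 6sQ), where wμ = 1 + sQ).
module Units where
  open import Data.Nat
  open import Data.Nat.Properties
  open import Data.Nat.DivMod
  open import Data.Nat.Divisibility using (_∣_; divides; m%n≡0⇒n∣m; n∣m⇒m%n≡0)
  open import Data.Nat.Primality using (Prime; prime?; euclidsLemma)
  open import Data.Nat.Tactic.RingSolver using (solve-∀)
  open import Data.Bool using (Bool; _∨_; T)
  open import Data.Bool.Properties using (T-∨)
  open import Data.Product using (Σ; _,_)
  open import Data.Sum using (inj₁; inj₂)
  open import Function.Bundles using (Equivalence)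
  open import Relation.Binary.PropositionalEquality
  open import Relation.Nullary using (contradiction)
  open import Relation.Nullary.Decidable using (from-yes)
  open import Defs using (N; Multiplier)
  open BoundedSearch

  private
    module ≈₇ = Congruence 7

  infixl 7 _%7^_
  _%7^_ : ℕ → ℕ → ℕ
  x %7^ e = _%_ x (7 ^ e) {{m^n≢0 7 e}}

  prime-7 : Prime 7
  prime-7 = from-yes (prime? 7)

  unit-* : ∀ a b → a % 7 ≢ 0 → b % 7 ≢ 0 → (a * b) % 7 ≢ 0
  unit-* a b a≢0 b≢0 ab≡0 with euclidsLemma a b prime-7 (m%n≡0⇒n∣m (a * b) 7 ab≡0)
  ... | inj₁ 7∣a = a≢0 (n∣m⇒m%n≡0 a 7 7∣a)
  ... | inj₂ 7∣b = b≢0 (n∣m⇒m%n≡0 b 7 7∣b)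

  %7^-%7 : ∀ e x → x %7^ suc e % 7 ≡ x % 7
  %7^-%7 e x = m∣n⇒o%n%m≡o%m 7 (7 ^ suc e) x {{_}} {{m^n≢0 7 (suc e)}}
                 (divides (7 ^ e) (*-comm 7 (7 ^ e)))

  inverse-unit : ∀ e w μ → (w * μ) %7^ suc e ≡ 1 → μ % 7 ≢ 0
  inverse-unit e w μ wμ≡1 μ≡0 = 0≢1 (begin
    0                      ≡⟨ 0≡wμ ⟩
    (w * μ) % 7            ≡⟨ %7^-%7 e (w * μ) ⟨
    (w * μ) %7^ suc e % 7  ≡⟨ cong (_% 7) wμ≡1 ⟩
    1                      ∎)
    where
      open ≡-Reasoning
      0≢1 : 0 ≢ 1
      0≢1 ()
      0≡wμ : 0 ≡ (w * μ) % 7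
      0≡wμ = sym (trans (≈₇.≈-*ˡ w {μ} {0} μ≡0) (cong (_% 7) (*-zeroʳ w)))

  invertible? : ℕ → Bool
  invertible? v = (v ≡ᵇ 0) ∨ Any< 7 (λ μ → (v * μ) % 7 ≡ᵇ 1)

  invertible-table : T (All< 7 invertible?)
  invertible-table = _

  inverse-mod-7 : ∀ w → w % 7 ≢ 0 → Σ ℕ (λ μ → (w * μ) % 7 ≡ 1)
  inverse-mod-7 w w≢0 with Equivalence.to T-∨ (All<-sound 7 invertible? invertible-table (m%n<n w 7))
  ... | inj₁ w≡0 = contradiction (≡ᵇ⇒≡ _ 0 w≡0) w≢0
  ... | inj₂ found with Any<-sound 7 _ found
  ...   | μ , _ , wμ≡1 = μ , trans (≈₇.≈-*ʳ μ {w} {w % 7} (sym (≈₇.%-≈ w))) (≡ᵇ⇒≡ _ 1 wμ≡1)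

  lift-inverse : ∀ e w μ → (w * μ) %7^ suc e ≡ 1
    → Σ ℕ (λ μ′ → (w * μ′) %7^ suc (suc e) ≡ 1)
  lift-inverse e w μ wμ≡1 = μ * (1 + 6 * s * Q) , (begin
    (w * (μ * (1 + 6 * s * Q))) % (7 * Q)                  ≡⟨ cong (_% (7 * Q)) expand ⟩
    (1 + (s + 6 * s * s * 7 ^ e) * (7 * Q)) % (7 * Q)      ≡⟨ [m+kn]%n≡m%n 1 (s + 6 * s * s * 7 ^ e) (7 * Q) ⟩
    1 % (7 * Q)                                            ≡⟨ m<n⇒m%n≡m 1<7Q ⟩
    1                                                      ∎)
    where
      open ≡-Reasoning
      Q = 7 ^ suc e
      instance
        Q≢0 : NonZero Q
        Q≢0 = m^n≢0 7 (suc e)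
        7Q≢0 : NonZero (7 * Q)
        7Q≢0 = m^n≢0 7 (suc (suc e))
      s = (w * μ) / Q
      wμ≡ : w * μ ≡ 1 + s * Q
      wμ≡ = trans (m≡m%n+[m/n]*n (w * μ) Q) (cong (_+ s * Q) wμ≡1)
      square : ∀ w μ s R → w * (μ * (1 + 6 * s * (7 * R)))
                         ≡ (w * μ) * (1 + 6 * s * (7 * R))
      square = solve-∀
      collect : ∀ s R → (1 + s * (7 * R)) * (1 + 6 * s * (7 * R))
                      ≡ 1 + (s + 6 * s * s * R) * (7 * (7 * R))
      collect = solve-∀
      expand : w * (μ * (1 + 6 * s * Q)) ≡ 1 + (s + 6 * s * s * 7 ^ e) * (7 * Q)
      expand = trans (square w μ s (7 ^ e))
                 (trans (cong (_* (1 + 6 * s * Q)) wμ≡) (collect s (7 ^ e)))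
      1<7Q : 1 < 7 * Q
      1<7Q = ≤-trans (s≤s (s≤s z≤n)) (*-monoʳ-≤ 7 (m^n>0 7 (suc e)))

  inverse : ∀ e w → w % 7 ≢ 0 → Σ ℕ (λ μ → (w * μ) %7^ suc e ≡ 1)
  inverse zero    w w≢0 = inverse-mod-7 w w≢0
  inverse (suc e) w w≢0 = let μ , wμ≡1 = inverse e w w≢0 in lift-inverse e w μ wμ≡1

  unit-multiplier : ∀ m λ′ → λ′ < N m → λ′ % 7 ≢ 0 → Multiplier m λ′
  unit-multiplier m λ′ λ′<N λ′≢0 = λ′<N , inverse m λ′ λ′≢0

module Digits (m : ℕ) where
  open import Defs using (N; q)
  open import Data.Nat
  open import Data.Nat.Properties
  open import Data.Nat.DivMod
  open import Data.Nat.Divisibility using (divides; divides-refl)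
  open import Data.Nat.Tactic.RingSolver using (solve-∀)
  open import Relation.Binary.PropositionalEquality

  P : ℕ
  P = 7 ^ m

  instance
    P≢0 : NonZero P
    P≢0 = m^n≢0 7 m
    N≢0 : NonZero (N m)
    N≢0 = m^n≢0 7 (suc m)

  private
    module ≈₇ = Congruence 7

  P<N : P < N m
  P<N = subst (_< N m) (*-identityˡ P) (*-monoˡ-< P {1} {7} (s≤s (s≤s z≤n)))

  1<N : 1 < N m
  1<N = <-≤-trans (s≤s (s≤s z≤n)) (*-monoʳ-≤ 7 (m^n>0 7 m))

  q<7 : ∀ x → q m x < 7
  q<7 x = m%n<n (x / P) 7

  q-%N : ∀ x → q m (x % N m) ≡ q m x
  q-%N x = trans (cong (_% 7) (m%[n*o]/o≡m/o%n x 7 P)) (m%n%n≡m%n (x / P) 7)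

  q-cong : ∀ {x y} → x % N m ≡ y % N m → q m x ≡ q m y
  q-cong {x} {y} x≈y = trans (sym (q-%N x)) (trans (cong (q m) x≈y) (q-%N y))

  /P-shift : ∀ x d → (x + d * P) / P ≡ x / P + d
  /P-shift x d = trans (+-distrib-/-∣ʳ x (divides-refl d)) (cong (x / P +_) (m*n/n≡m d P))

  q-shift : ∀ x d → q m (x + d * P) ≡ (q m x + d) % 7
  q-shift x d = trans (cong (_% 7) (/P-shift x d)) (sym (≈₇.%-+ˡ (x / P) d))

  low-cong : ∀ {x y} → x % N m ≡ y % N m → x % P ≡ y % P
  low-cong {x} {y} x≈y = begin
    x % P           ≡⟨ m∣n⇒o%n%m≡o%m P (N m) x P∣N ⟨
    x % N m % P     ≡⟨ cong (_% P) x≈y ⟩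
    y % N m % P     ≡⟨ m∣n⇒o%n%m≡o%m P (N m) y P∣N ⟩
    y % P           ∎
    where
      open ≡-Reasoning
      P∣N = divides 7 refl

  carry : ℕ → ℕ → ℕ
  carry x y = (x % P + y % P) / P

  q-sum : ∀ x y → q m (x + y) ≡ (q m x + q m y + carry x y) % 7
  q-sum x y = begin
    q m (x + y)                                       ≡⟨ cong (q m) split ⟩
    q m ((x % P + y % P) + (x / P + y / P) * P)       ≡⟨ cong (_% 7) (/P-shift (x % P + y % P) (x / P + y / P)) ⟩
    (carry x y + (x / P + y / P)) % 7                 ≡⟨ cong (_% 7) (+-comm (carry x y) (x / P + y / P)) ⟩
    (x / P + y / P + carry x y) % 7                   ≡⟨ ≈₇.≈-+ʳ (carry x y) {q m x + q m y} {x / P + y / P} (≈₇.%-+-% (x / P) (y / P)) ⟨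
    (q m x + q m y + carry x y) % 7                   ∎
    where
      open ≡-Reasoning
      regroup : ∀ a b c d p → (a + b * p) + (c + d * p) ≡ (a + c) + (b + d) * p
      regroup = solve-∀
      split : x + y ≡ (x % P + y % P) + (x / P + y / P) * P
      split = trans (cong₂ _+_ (m≡m%n+[m/n]*n x P) (m≡m%n+[m/n]*n y P))
                    (regroup (x % P) (x / P) (y % P) (y / P) P)

  carry≤1 : ∀ x y → carry x y ≤ 1
  carry≤1 x y = ≤-pred (m<n*o⇒m/o<n {n = 2} (+-mono-< (m%n<n x P) (subst (y % P <_) (sym (+-identityʳ P)) (m%n<n y P))))

  carry-mono : ∀ x {y y′} → y % P ≤ y′ % P → carry x y ≤ carry x y′
  carry-mono x le = /-monoˡ-≤ P (+-monoʳ-≤ (x % P) le)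

  carry-cong : ∀ x {y y′} → y % N m ≡ y′ % N m → carry x y ≡ carry x y′
  carry-cong x y≈y′ = cong (λ v → (x % P + v) / P) (low-cong y≈y′)

module IntegerReduction where
  open import Defs using (N; modN)
  open import Data.Nat as ℕ using (ℕ; zero; suc; NonZero)
  import Data.Nat.Properties as ℕP
  import Data.Nat.DivMod as ℕD
  open import Data.Integer using (ℤ; +_; -[1+_]; _+_; _*_; -_; _-_; _%ℕ_; _/ℕ_)
  open import Data.Integer.Properties using (+-injective; pos-+; pos-*; *-comm; *-assoc)
  open import Data.Integer.DivMod using (a≡a%ℕn+[a/ℕn]*n; n%ℕd<d)
  open import Data.Integer.Tactic.RingSolver using (solve-∀)
  open import Relation.Binary.PropositionalEquality
  open import Relation.Nullary using (¬_; contradiction)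

  private
    not-below : ∀ {r r′} k d → + r ≡ + r′ + + suc k * + d → ¬ (r ℕ.< d)
    not-below {r} {r′} k d eq r<d = ℕP.<⇒≱ r<d (subst (d ℕ.≤_) (sym r≡) d≤)
      where
        r≡ : r ≡ r′ ℕ.+ suc k ℕ.* d
        r≡ = +-injective (trans eq (trans (cong (_+_ (+ r′)) (sym (pos-* (suc k) d)))
                                          (sym (pos-+ r′ (suc k ℕ.* d)))))
        d≤ : d ℕ.≤ r′ ℕ.+ suc k ℕ.* d
        d≤ = ℕP.≤-trans (ℕP.m≤m+n d (k ℕ.* d)) (ℕP.m≤n+m (suc k ℕ.* d) r′)

  remainder-unique : ∀ {r r′ d} (δ : ℤ) → r ℕ.< d → r′ ℕ.< d → + r ≡ + r′ + δ * + d → r ≡ r′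
  remainder-unique {r} {r′} {d} (+ zero) _ _ eq = +-injective (trans eq (drop-zero (+ r′) (+ d)))
    where
      drop-zero : ∀ a d → a + + 0 * d ≡ a
      drop-zero = solve-∀
  remainder-unique (+ suc k) r<d _ eq = contradiction r<d (not-below k _ eq)
  remainder-unique {r} {r′} {d} -[1+ k ] _ r′<d eq = contradiction r′<d (not-below k d flipped)
    where
      move : ∀ a c e → a ≡ (a + (- c) * e) + c * e
      move = solve-∀
      flipped : + r′ ≡ + r + + suc k * + d
      flipped = trans (move (+ r′) (+ suc k) (+ d)) (cong (_+ + suc k * + d) (sym eq))

  %ℕ-unique : ∀ x d .{{_ : NonZero d}} (r : ℕ) (t : ℤ) → r ℕ.< d → x ≡ + r + t * + d → x %ℕ d ≡ r
  %ℕ-unique x d r t r<d x≡ = sym (remainder-unique ((x /ℕ d) - t) r<d (n%ℕd<d x d) (begin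
    + r                                       ≡⟨ unshift (+ r) t (+ d) ⟩
    (+ r + t * + d) - t * + d                 ≡⟨ cong (_- t * + d) x≡ ⟨
    x - t * + d                               ≡⟨ cong (_- t * + d) (a≡a%ℕn+[a/ℕn]*n x d) ⟩
    (+ (x %ℕ d) + (x /ℕ d) * + d) - t * + d   ≡⟨ regroup (+ (x %ℕ d)) (x /ℕ d) t (+ d) ⟩
    + (x %ℕ d) + ((x /ℕ d) - t) * + d         ∎))
    where
      open ≡-Reasoning
      unshift : ∀ a t d → a ≡ (a + t * d) - t * d
      unshift = solve-∀
      regroup : ∀ a s t d → (a + s * d) - t * d ≡ a + (s - t) * d
      regroup = solve-∀

  %ℕ-≡ : ∀ x d .{{_ : NonZero d}} (a : ℕ) (t : ℤ) → x ≡ + a + t * + d → x %ℕ d ≡ a ℕ.% d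
  %ℕ-≡ x d a t x≡ = %ℕ-unique x d (a ℕ.% d) (+ (a ℕ./ d) + t) (ℕD.m%n<n a d) (begin
    x                                                   ≡⟨ x≡ ⟩
    + a + t * + d                                       ≡⟨ cong (λ v → v + t * + d) a≡ ⟩
    + (a ℕ.% d) + + (a ℕ./ d) * + d + t * + d           ≡⟨ regroup (+ (a ℕ.% d)) (+ (a ℕ./ d)) t (+ d) ⟩
    + (a ℕ.% d) + (+ (a ℕ./ d) + t) * + d               ∎)
    where
      open ≡-Reasoning
      a≡ : + a ≡ + (a ℕ.% d) + + (a ℕ./ d) * + d
      a≡ = trans (cong +_ (ℕD.m≡m%n+[m/n]*n a d))
                 (trans (pos-+ (a ℕ.% d) (a ℕ./ d ℕ.* d)) (cong (_+_ (+ (a ℕ.% d))) (pos-* (a ℕ./ d) d)))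
      regroup : ∀ r s t d → r + s * d + t * d ≡ r + (s + t) * d
      regroup = solve-∀

  module ReductionModN (m : ℕ) where
    instance
      N≢0 : NonZero (N m)
      N≢0 = ℕP.m^n≢0 7 (suc m)

    modN-split : ∀ b → b ≡ + modN m b + (b /ℕ N m) * + N m
    modN-split b = a≡a%ℕn+[a/ℕn]*n b (N m)

    modN-*ˡ : ∀ (k : ℕ) b → modN m (+ k * b) ≡ (k ℕ.* modN m b) ℕ.% N m
    modN-*ˡ k b = %ℕ-≡ (+ k * b) (N m) (k ℕ.* modN m b) (+ k * (b /ℕ N m)) (begin
      + k * b                                            ≡⟨ cong (+ k *_) (modN-split b) ⟩
      + k * (+ modN m b + (b /ℕ N m) * + N m)            ≡⟨ distrib (+ k) (+ modN m b) (b /ℕ N m) (+ N m) ⟩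
      + k * + modN m b + + k * (b /ℕ N m) * + N m        ≡⟨ cong (_+ + k * (b /ℕ N m) * + N m) (pos-* k (modN m b)) ⟨
      + (k ℕ.* modN m b) + + k * (b /ℕ N m) * + N m      ∎)
      where
        open ≡-Reasoning
        distrib : ∀ a c t n → a * (c + t * n) ≡ a * c + a * t * n
        distrib = solve-∀

    modN-*ʳ : ∀ u (k : ℕ) → modN m (u * + k) ≡ (modN m u ℕ.* k) ℕ.% N m
    modN-*ʳ u k = trans (cong (modN m) (*-comm u (+ k)))
                        (trans (modN-*ˡ k u) (cong (ℕ._% N m) (ℕP.*-comm k (modN m u))))

    modN-+ : ∀ x y → modN m (x + y) ≡ (modN m x ℕ.+ modN m y) ℕ.% N m
    modN-+ x y = %ℕ-≡ (x + y) (N m) (modN m x ℕ.+ modN m y) ((x /ℕ N m) + (y /ℕ N m)) (begin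
      x + y                                                            ≡⟨ cong₂ _+_ (modN-split x) (modN-split y) ⟩
      (+ modN m x + (x /ℕ N m) * + N m) + (+ modN m y + (y /ℕ N m) * + N m)
                                                                       ≡⟨ regroup (+ modN m x) (+ modN m y) (x /ℕ N m) (y /ℕ N m) (+ N m) ⟩
      (+ modN m x + + modN m y) + ((x /ℕ N m) + (y /ℕ N m)) * + N m    ≡⟨ cong (_+ ((x /ℕ N m) + (y /ℕ N m)) * + N m) (pos-+ (modN m x) (modN m y)) ⟨
      + (modN m x ℕ.+ modN m y) + ((x /ℕ N m) + (y /ℕ N m)) * + N m    ∎)
      where
        open ≡-Reasoning
        regroup : ∀ a b s t n → (a + s * n) + (b + t * n) ≡ (a + b) + (s + t) * n
        regroup = solve-∀

    modN-%7 : ∀ u → modN m u ℕ.% 7 ≡ u %ℕ 7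
    modN-%7 u = sym (%ℕ-≡ u 7 (modN m u) ((u /ℕ N m) * + (7 ℕ.^ m)) (begin
      u                                               ≡⟨ modN-split u ⟩
      + modN m u + (u /ℕ N m) * + N m                 ≡⟨ cong (λ v → + modN m u + (u /ℕ N m) * v) N≡ ⟩
      + modN m u + (u /ℕ N m) * (+ (7 ℕ.^ m) * + 7)   ≡⟨ cong (_+_ (+ modN m u)) (*-assoc (u /ℕ N m) (+ (7 ℕ.^ m)) (+ 7)) ⟨
      + modN m u + (u /ℕ N m) * + (7 ℕ.^ m) * + 7     ∎))
      where
        open ≡-Reasoning
        N≡ : + N m ≡ + (7 ℕ.^ m) * + 7
        N≡ = trans (cong +_ (ℕP.*-comm 7 (7 ℕ.^ m))) (pos-* (7 ℕ.^ m) 7)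

module Valuation where
  open import Defs using (N; νℕ-go; ν; r; modN)
  open import Data.Nat
  open import Data.Nat.Properties
  open import Data.Nat.DivMod
  open import Data.Nat.Divisibility using (_∣_; divides; 1∣_; *-monoʳ-∣)
  open import Data.Integer as ℤ using (ℤ; +_; -[1+_]; ∣_∣; _%ℕ_; _/ℕ_; 0ℤ)
  import Data.Integer.Properties as ℤP
  open import Data.Integer.DivMod using (a≡a%ℕn+[a/ℕn]*n)
  open import Data.Integer.Tactic.RingSolver using (solve-∀)
  open import Data.Product using (Σ; _×_; _,_)
  open import Relation.Binary.PropositionalEquality
  open import Relation.Nullary using (contradiction)
  open IntegerReduction

  private
    7^≢0 : ∀ k → NonZero (7 ^ k)
    7^≢0 k = m^n≢0 7 k

    _/7^_ : ℕ → ℕ → ℕ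
    n /7^ k = _/_ n (7 ^ k) {{7^≢0 k}}

  pow-ν-divides : ∀ f n → 7 ^ νℕ-go f n ∣ n
  pow-ν-divides zero    n = 1∣ n
  pow-ν-divides (suc f) n with n % 7 in n%7
  ... | zero  = subst (7 ^ suc (νℕ-go f (n / 7)) ∣_) (sym n≡) (*-monoʳ-∣ 7 (pow-ν-divides f (n / 7)))
    where
      n≡ : n ≡ 7 * (n / 7)
      n≡ = trans (m≡m%n+[m/n]*n n 7) (trans (cong (_+ (n / 7) * 7) n%7) (*-comm (n / 7) 7))
  ... | suc _ = 1∣ n

  cofactor-unit : ∀ f n → n ≢ 0 → n ≤ f → (n /7^ νℕ-go f n) % 7 ≢ 0
  cofactor-unit zero    n n≢0 n≤0 = contradiction (n≤0⇒n≡0 n≤0) n≢0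
  cofactor-unit (suc f) n n≢0 n≤1+f with n % 7 in n%7
  ... | suc _ = λ n%7≡0 → 0≢1+n (trans (sym n%7≡0) (trans (cong (_% 7) (n/1≡n n)) n%7))
  ... | zero  = λ e → cofactor-unit f (n / 7) n/7≢0 n/7≤f (trans (cong (_% 7) regroup) e)
    where
      instance
        n≢0′ : NonZero n
        n≢0′ = ≢-nonZero n≢0
      k = νℕ-go f (n / 7)
      n≡ : n ≡ (n / 7) * 7
      n≡ = trans (m≡m%n+[m/n]*n n 7) (cong (_+ (n / 7) * 7) n%7)
      n/7≢0 : n / 7 ≢ 0
      n/7≢0 n/7≡0 = n≢0 (trans n≡ (cong (_* 7) n/7≡0))
      n/7≤f : n / 7 ≤ f
      n/7≤f = ≤-pred (<-≤-trans (m/n<m n 7 (s≤s (s≤s z≤n))) n≤1+f)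
      regroup : (n / 7) /7^ k ≡ n /7^ suc k
      regroup = m/n/o≡m/[n*o] n 7 (7 ^ k) {{_}} {{7^≢0 k}} {{7^≢0 (suc k)}}

  module Cofactor (x : ℤ) (x≢0 : x ≢ 0ℤ) where
    h = ν x

    instance
      7^h≢0 : NonZero (7 ^ h)
      7^h≢0 = 7^≢0 h

    u : ℤ
    u = x /ℕ (7 ^ h)

    x≡u*7^h : x ≡ u ℤ.* + (7 ^ h)
    x≡u*7^h = trans (a≡a%ℕn+[a/ℕn]*n x (7 ^ h)) (trans (cong (λ v → + v ℤ.+ u ℤ.* + (7 ^ h)) divisible) (ℤP.+-identityˡ _))
      where
        w = _∣_.quotient (pow-ν-divides ∣ x ∣ ∣ x ∣)
        ∣x∣≡ : ∣ x ∣ ≡ w * 7 ^ h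
        ∣x∣≡ = _∣_.equality (pow-ν-divides ∣ x ∣ ∣ x ∣)
        -- x = ±w·7^h (the equation y ≡ x lets us split on the sign of x)
        signed : ∀ y → y ≡ x → Σ ℤ (λ t → y ≡ + 0 ℤ.+ t ℤ.* + (7 ^ h))
        signed (+ n) refl = + w , trans (cong +_ ∣x∣≡) (trans (ℤP.pos-* w (7 ^ h)) (sym (ℤP.+-identityˡ _)))
        signed -[1+ n ] refl = ℤ.- (+ w) , trans (cong (λ v → ℤ.- (+ v)) ∣x∣≡)
          (trans (cong ℤ.-_ (ℤP.pos-* w (7 ^ h))) (negate (+ w) (+ (7 ^ h))))
          where
            negate : ∀ a b → ℤ.- (a ℤ.* b) ≡ + 0 ℤ.+ (ℤ.- a) ℤ.* b
            negate = solve-∀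
        divisible : x %ℕ (7 ^ h) ≡ 0
        divisible = let t , x≡ = signed x refl in %ℕ-unique x (7 ^ h) 0 t (m^n>0 7 h) x≡

    -- r(x) ≢ 0: otherwise 7 would divide |x| / 7^ν(x)
    r≢0 : r x ≢ 0
    r≢0 r≡0 = cofactor-unit ∣ x ∣ ∣ x ∣ (λ e → x≢0 (ℤP.∣i∣≡0⇒i≡0 e)) ≤-refl
      (trans (cong (_% 7) x/7^h≡) (m*n%n≡0 ∣ u /ℕ 7 ∣ 7))
      where
        u≡ : u ≡ (u /ℕ 7) ℤ.* + 7
        u≡ = trans (a≡a%ℕn+[a/ℕn]*n u 7) (trans (cong (λ v → + v ℤ.+ (u /ℕ 7) ℤ.* + 7) r≡0) (ℤP.+-identityˡ _))
        ∣x∣≡ : ∣ x ∣ ≡ (∣ u /ℕ 7 ∣ * 7) * 7 ^ h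
        ∣x∣≡ = trans (cong ∣_∣ (trans x≡u*7^h (cong (ℤ._* + (7 ^ h)) u≡)))
                     (trans (ℤP.abs-* ((u /ℕ 7) ℤ.* + 7) (+ (7 ^ h))) (cong (_* 7 ^ h) (ℤP.abs-* (u /ℕ 7) (+ 7))))
        x/7^h≡ : ∣ x ∣ / 7 ^ h ≡ ∣ u /ℕ 7 ∣ * 7
        x/7^h≡ = trans (cong (_/ 7 ^ h) ∣x∣≡) (m*n/n≡m (∣ u /ℕ 7 ∣ * 7) (7 ^ h))

  module _ (m : ℕ) where
    open ReductionModN m

    unit-times-power : ∀ x → x ≢ 0ℤ → Σ ℕ (λ U → modN m x ≡ (U * 7 ^ ν x) % N m × U % 7 ≡ r x)
    unit-times-power x x≢0 = modN m u , trans (cong (modN m) x≡u*7^h) (modN-*ʳ u (7 ^ ν x)) , modN-%7 u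
      where open Cofactor x x≢0

-- In every application e = q(λb₃) and a, b
-- are e shifted by a digit plus a carry in {0,1}; the carries may be
-- constrained to be ordered.  Since windows are invariant under rotation of
-- ℤ₇, only e = 0 has to be tabulated.
module Windows where
  open import Defs using (ℓ)
  open import Data.Nat
  open import Data.Nat.Properties using (≤ᵇ⇒≤; ≡ᵇ⇒≡; +-assoc)
  open import Data.Nat.DivMod using (m%n<n)
  open import Data.Bool using (Bool; true; false; not; _∨_; T)
  open import Data.Bool.Properties using (T-∨)
  open import Data.Empty using (⊥; ⊥-elim)
  open import Data.List using (_∷_; [])
  open import Data.Sum using (inj₁; inj₂)
  open import Function.Bundles using (Equivalence)
  open import Relation.Binary.PropositionalEquality
  open BoundedSearch

  private
    module ≈₇ = Congruence 7

  ℓ₃ : ℕ → ℕ → ℕ → ℕ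
  ℓ₃ a b e = ℓ (a ∷ b ∷ e ∷ [])

  rotation-invariant : ℕ → ℕ → ℕ → Bool
  rotation-invariant e a b = ℓ₃ ((e + a) % 7) ((e + b) % 7) e ≡ᵇ ℓ₃ a b 0

  rotation-table : T (All< 7 (λ e → All< 7 (λ a → All< 7 (rotation-invariant e a))))
  rotation-table = _

  ℓ₃-rotate : ∀ e a b → e < 7 → ℓ₃ ((e + a) % 7) ((e + b) % 7) e ≡ ℓ₃ (a % 7) (b % 7) 0
  ℓ₃-rotate e a b e<7 = begin
    ℓ₃ ((e + a) % 7) ((e + b) % 7) e              ≡⟨ cong₂ (λ u v → ℓ₃ u v e) (≈₇.%-+ʳ e a) (≈₇.%-+ʳ e b) ⟨
    ℓ₃ ((e + a % 7) % 7) ((e + b % 7) % 7) e      ≡⟨ ≡ᵇ⇒≡ _ _ entry ⟩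
    ℓ₃ (a % 7) (b % 7) 0                          ∎
    where
      open ≡-Reasoning
      entry : T (rotation-invariant e (a % 7) (b % 7))
      entry = All<-sound 7 (rotation-invariant e (a % 7))
                (All<-sound 7 (λ a → All< 7 (rotation-invariant e a))
                  (All<-sound 7 (λ e → All< 7 (λ a → All< 7 (rotation-invariant e a))) rotation-table e<7)
                  (m%n<n a 7))
                (m%n<n b 7)

  data CarryOrder : Set where
    unordered ascending descending : CarryOrder

  admits : CarryOrder → ℕ → ℕ → Bool
  admits unordered  c₁ c₂ = true
  admits ascending  c₁ c₂ = c₁ ≤ᵇ c₂
  admits descending c₁ c₂ = c₂ ≤ᵇ c₁

  spread-fits : ℕ → CarryOrder → ℕ → ℕ → ℕ → ℕ → Bool
  spread-fits L o d₁ d₂ c₁ c₂ = not (admits o c₁ c₂) ∨ (ℓ₃ ((d₁ + c₁) % 7) ((d₂ + c₂) % 7) 0 ≤ᵇ L)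

  spread≤ : ℕ → CarryOrder → ℕ → ℕ → Bool
  spread≤ L o d₁ d₂ = All< 2 (λ c₁ → All< 2 (spread-fits L o d₁ d₂ c₁))

  spread≤-sound : ∀ {L o d₁ d₂ e c₁ c₂} → T (spread≤ L o d₁ d₂) → e < 7 → c₁ ≤ 1 → c₂ ≤ 1
    → T (admits o c₁ c₂) → ℓ₃ ((e + d₁ + c₁) % 7) ((e + d₂ + c₂) % 7) e ≤ L
  spread≤-sound {L} {o} {d₁} {d₂} {e} {c₁} {c₂} t e<7 c₁≤1 c₂≤1 ok
    with Equivalence.to T-∨ (All<-sound 2 (spread-fits L o d₁ d₂ c₁)
           (All<-sound 2 (λ c₁ → All< 2 (spread-fits L o d₁ d₂ c₁)) t (s≤s c₁≤1)) (s≤s c₂≤1))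
  ... | inj₁ ¬ok = ⊥-elim (not-both (admits o c₁ c₂) ¬ok ok)
    where
      not-both : ∀ b → T (not b) → T b → ⊥
      not-both false _ ()
  ... | inj₂ fits = subst (_≤ L) (sym rotated) (≤ᵇ⇒≤ _ _ fits)
    where
      rotated : ℓ₃ ((e + d₁ + c₁) % 7) ((e + d₂ + c₂) % 7) e ≡ ℓ₃ ((d₁ + c₁) % 7) ((d₂ + c₂) % 7) 0
      rotated = trans (cong₂ (λ u v → ℓ₃ (u % 7) (v % 7) e) (+-assoc e d₁ c₁) (+-assoc e d₂ c₂))
                      (ℓ₃-rotate e (d₁ + c₁) (d₂ + c₂) e<7)

-- Proof: with s = ⌊60 z′/P⌋ (z′ = z mod 7P, so s < 420) a finite search finds
-- for each s an a such that c = ⌊a s/60⌋ satisfies a(s+1) ≤ 60(c+1), hence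
-- ⌊a z′/P⌋ = c, and either c mod 7 ≤ 1 or c mod 7 = 6 with enough room above 6P.
module Approximation (P : ℕ) {{_ : NonZero P}} (6≤P : 6 ≤ P) where
  open import Data.Nat
  open import Data.Nat.Properties
  open import Data.Nat.DivMod
  open import Data.Nat.Tactic.RingSolver using (solve-∀)
  open import Data.Bool using (Bool; _∧_; _∨_; T)
  open import Data.Bool.Properties using (T-∧; T-∨)
  open import Data.Product using (Σ; _×_; _,_; proj₁; proj₂)
  open import Data.Sum using (_⊎_; inj₁; inj₂)
  open import Function.Bundles using (Equivalence)
  open import Relation.Binary.PropositionalEquality
  open BoundedSearch

  instance
    7P≢0 : NonZero (7 * P)
    7P≢0 = m*n≢0 7 P

  private
    module ≈₇ₚ = Congruence (7 * P)

  suitable : ℕ → ℕ → Bool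
  suitable s a = (1 ≤ᵇ a) ∧ ((a * suc s ≤ᵇ 60 * suc c) ∧
               ((c % 7 ≤ᵇ 1) ∨ ((c % 7 ≡ᵇ 6) ∧ (60 * a ≤ᵇ (a * s ∸ 60 * c) * 6))))
    where c = (a * s) / 60

  suitable-exists : ∀ {s} → s < 420 → Σ ℕ (λ a → a < 7 × T (suitable s a))
  suitable-exists s<420 = Any<-sound 7 (suitable _) (All<-sound 420 (λ s → Any< 7 (suitable s)) table s<420)
    where
      table : T (All< 420 (λ s → Any< 7 (suitable s)))
      table = _

  digits-below-7P : ∀ {d l} → d ≤ 6 → l < P → d * P + l < 7 * P
  digits-below-7P {d} {l} d≤6 l<P = begin-strict
    d * P + l   <⟨ +-monoʳ-< (d * P) l<P ⟩
    d * P + P   ≤⟨ +-monoˡ-≤ P (*-monoˡ-≤ P d≤6) ⟩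
    6 * P + P   ≡⟨ six-plus-one P ⟩
    7 * P       ∎
    where
      open ≤-Reasoning
      six-plus-one : ∀ P → 6 * P + P ≡ 7 * P
      six-plus-one = solve-∀

  remainder<P : ∀ v c → c * P ≤ v → v < suc c * P → v ∸ c * P < P
  remainder<P v c lower upper = +-cancelˡ-< (c * P) (v ∸ c * P) P
    (subst (_< c * P + P) (sym (m+[n∸m]≡n lower)) (subst (v <_) (+-comm P (c * P)) upper))

  reduce : ∀ v c → c * P ≤ v → v < suc c * P → v % (7 * P) ≡ (c % 7) * P + (v ∸ c * P)
  reduce v c lower upper = begin
    v % (7 * P)                                          ≡⟨ cong (_% (7 * P)) v≡ ⟩
    ((c % 7) * P + l + (c / 7) * (7 * P)) % (7 * P)      ≡⟨ [m+kn]%n≡m%n ((c % 7) * P + l) (c / 7) (7 * P) ⟩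
    ((c % 7) * P + l) % (7 * P)                          ≡⟨ m<n⇒m%n≡m (digits-below-7P (≤-pred (m%n<n c 7)) (remainder<P v c lower upper)) ⟩
    (c % 7) * P + l                                      ∎
    where
      open ≡-Reasoning
      l = v ∸ c * P
      regroup : ∀ d k P l → (d + k * 7) * P + l ≡ d * P + l + k * (7 * P)
      regroup = solve-∀
      v≡ : v ≡ (c % 7) * P + l + (c / 7) * (7 * P)
      v≡ = trans (sym (m+[n∸m]≡n lower))
        (trans (cong (λ x → x * P + l) (m≡m%n+[m/n]*n c 7)) (regroup (c % 7) (c / 7) P l))

  module _ (z : ℕ) where
    z′ = z % (7 * P)
    s = (60 * z′) / P

    s<420 : s < 420
    s<420 = m<n*o⇒m/o<n {60 * z′} {420} {P}
      (subst (60 * z′ <_) (times-420 P) (*-monoʳ-< 60 (m%n<n z (7 * P))))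
      where
        times-420 : ∀ P → 60 * (7 * P) ≡ 420 * P
        times-420 = solve-∀

    sP≤60z′ : s * P ≤ 60 * z′
    sP≤60z′ = m/n*n≤m (60 * z′) P

    60z′<[1+s]P : 60 * z′ < suc s * P
    60z′<[1+s]P = subst (_< suc s * P) (sym (m≡m%n+[m/n]*n (60 * z′) P))
                        (+-monoˡ-< (s * P) (m%n<n (60 * z′) P))

    module Floor (a : ℕ) {{_ : NonZero a}} (fits : a * suc s ≤ 60 * suc ((a * s) / 60)) where
      c = (a * s) / 60

      lower : c * P ≤ a * z′
      lower = *-cancelˡ-≤ 60 (begin
        60 * (c * P)     ≡⟨ swap c P ⟩
        (c * 60) * P     ≤⟨ *-monoˡ-≤ P (m/n*n≤m (a * s) 60) ⟩
        (a * s) * P      ≡⟨ *-assoc a s P ⟩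
        a * (s * P)      ≤⟨ *-monoʳ-≤ a sP≤60z′ ⟩
        a * (60 * z′)    ≡⟨ assoc a z′ ⟩
        60 * (a * z′)    ∎)
        where
          open ≤-Reasoning
          swap : ∀ c P → 60 * (c * P) ≡ (c * 60) * P
          swap = solve-∀
          assoc : ∀ a z → a * (60 * z) ≡ 60 * (a * z)
          assoc = solve-∀

      upper : a * z′ < suc c * P
      upper = *-cancelˡ-< 60 (a * z′) (suc c * P) (begin-strict
        60 * (a * z′)        ≡⟨ assoc a z′ ⟩
        a * (60 * z′)        <⟨ *-monoʳ-< a 60z′<[1+s]P ⟩
        a * (suc s * P)      ≡⟨ *-assoc a (suc s) P ⟨
        (a * suc s) * P      ≤⟨ *-monoˡ-≤ P fits ⟩
        (60 * suc c) * P     ≡⟨ *-assoc 60 (suc c) P ⟩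
        60 * (suc c * P)     ∎)
        where
          open ≤-Reasoning
          assoc : ∀ a z → 60 * (a * z) ≡ a * (60 * z)
          assoc = solve-∀

      az≡ : (a * z) % (7 * P) ≡ (c % 7) * P + (a * z′ ∸ c * P)
      az≡ = trans (sym (≈₇ₚ.%-*ʳ a z)) (reduce (a * z′) c lower upper)

      low-case : c % 7 ≤ 1 → (a * z) % (7 * P) < 2 * P
      low-case c≤1 = subst (_< 2 * P) (sym az≡) (begin-strict
        (c % 7) * P + l   ≤⟨ +-monoˡ-≤ l (*-monoˡ-≤ P c≤1) ⟩
        1 * P + l         <⟨ +-monoʳ-< (1 * P) (remainder<P (a * z′) c lower upper) ⟩
        1 * P + P         ≡⟨ one-plus-one P ⟩
        2 * P             ∎)
        where
          open ≤-Reasoning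
          l = a * z′ ∸ c * P
          one-plus-one : ∀ P → 1 * P + P ≡ 2 * P
          one-plus-one = solve-∀

      room : 60 * a ≤ (a * s ∸ 60 * c) * 6 → a ≤ a * z′ ∸ c * P
      room enough = *-cancelˡ-≤ 60 (begin
        60 * a                       ≤⟨ enough ⟩
        (a * s ∸ 60 * c) * 6         ≤⟨ *-monoʳ-≤ (a * s ∸ 60 * c) 6≤P ⟩
        (a * s ∸ 60 * c) * P         ≡⟨ *-distribʳ-∸ P (a * s) (60 * c) ⟩
        a * s * P ∸ 60 * c * P       ≤⟨ m≤n+o⇒m∸n≤o (a * s * P) (60 * c * P) asP≤ ⟩
        60 * (a * z′ ∸ c * P)        ∎)
        where
          open ≤-Reasoning
          assoc : ∀ a s P → a * s * P ≡ a * (s * P)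
          assoc = solve-∀
          distrib : ∀ a z → a * (60 * z) ≡ 60 * (a * z)
          distrib = solve-∀
          expand : ∀ c P l → 60 * (c * P + l) ≡ 60 * c * P + 60 * l
          expand = solve-∀
          asP≤ : a * s * P ≤ 60 * c * P + 60 * (a * z′ ∸ c * P)
          asP≤ = begin
            a * s * P                          ≡⟨ assoc a s P ⟩
            a * (s * P)                        ≤⟨ *-monoʳ-≤ a sP≤60z′ ⟩
            a * (60 * z′)                      ≡⟨ distrib a z′ ⟩
            60 * (a * z′)                      ≡⟨ cong (60 *_) (m+[n∸m]≡n lower) ⟨
            60 * (c * P + (a * z′ ∸ c * P))    ≡⟨ expand c P (a * z′ ∸ c * P) ⟩
            60 * c * P + 60 * (a * z′ ∸ c * P) ∎

      high-case : c % 7 ≡ 6 → 60 * a ≤ (a * s ∸ 60 * c) * 6 → 6 * P + a ≤ (a * z) % (7 * P)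
      high-case c≡6 enough = subst (6 * P + a ≤_) (sym az≡)
        (subst (λ d → 6 * P + a ≤ d * P + (a * z′ ∸ c * P)) (sym c≡6) (+-monoʳ-≤ (6 * P) (room enough)))

    short-multiple : Σ ℕ (λ a → 1 ≤ a × a ≤ 6 × ((a * z) % (7 * P) < 2 * P ⊎ 6 * P + a ≤ (a * z) % (7 * P)))
    short-multiple = from-suitable (suitable-exists s<420)
      where
        from-suitable : Σ ℕ (λ a → a < 7 × T (suitable s a))
          → Σ ℕ (λ a → 1 ≤ a × a ≤ 6 × ((a * z) % (7 * P) < 2 * P ⊎ 6 * P + a ≤ (a * z) % (7 * P)))
        from-suitable (a , a<7 , t) = a , 1≤a , ≤-pred a<7 , cases (Equivalence.to T-∨ (proj₂ rest))
          where
            parts = Equivalence.to T-∧ t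
            1≤a : 1 ≤ a
            1≤a = ≤ᵇ⇒≤ 1 a (proj₁ parts)
            instance
              a≢0 : NonZero a
              a≢0 = >-nonZero 1≤a
            rest = Equivalence.to T-∧ (proj₂ parts)
            open Floor a (≤ᵇ⇒≤ _ _ (proj₁ rest))
            cases : T (c % 7 ≤ᵇ 1) ⊎ T ((c % 7 ≡ᵇ 6) ∧ (60 * a ≤ᵇ (a * s ∸ 60 * c) * 6))
                  → (a * z) % (7 * P) < 2 * P ⊎ 6 * P + a ≤ (a * z) % (7 * P)
            cases (inj₁ c≤1) = inj₁ (low-case (≤ᵇ⇒≤ (c % 7) 1 c≤1))
            cases (inj₂ six) = let c≡6 , enough = Equivalence.to T-∧ six
                               in inj₂ (high-case (≡ᵇ⇒≡ (c % 7) 6 c≡6) (≤ᵇ⇒≤ _ _ enough))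

module Shape (m : ℕ) (b₁ b₂ b₃ : ℤ) where
  open import Defs using (N; q; modN; _·[_]_; ℓ·)
  open import Data.Nat
  open import Data.Nat.Properties using (*-distribˡ-+; +-comm)
  open import Data.Integer as ℤ using (_-_)
  open import Data.Integer.Tactic.RingSolver using (solve-∀)
  open import Data.Bool using (T)
  open import Data.List using (_∷_; [])
  open import Data.Sum using (_⊎_)
  open import Relation.Binary.PropositionalEquality
  open Digits m
  open IntegerReduction
  open Windows

  open ReductionModN m

  private
    module ≈₇ = Congruence 7
    module ≈N = Congruence (N m)

  GoodDigit : ℕ → Set
  GoodDigit v = v ≡ 0 ⊎ v ≡ 5 ⊎ v ≡ 6

  X Y B₃ : ℕ
  X  = modN m (b₁ - b₃)
  Y  = modN m (b₂ - b₃)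
  B₃ = modN m b₃

  q-· : ∀ λ′ b → q m (λ′ ·[ m ] b) ≡ q m (λ′ * modN m b)
  q-· λ′ b = trans (cong (q m) (modN-*ˡ λ′ b)) (q-%N (λ′ * modN m b))

  q-·-shifted : ∀ λ′ b → q m (λ′ ·[ m ] b)
    ≡ (q m (λ′ * B₃) + q m (λ′ * modN m (b - b₃)) + carry (λ′ * B₃) (λ′ * modN m (b - b₃))) % 7
  q-·-shifted λ′ b = begin
    q m (λ′ ·[ m ] b)                        ≡⟨ q-· λ′ b ⟩
    q m (λ′ * modN m b)                      ≡⟨ cong (λ v → q m (λ′ * modN m v)) (split b b₃) ⟩
    q m (λ′ * modN m ((b - b₃) ℤ.+ b₃))      ≡⟨ cong (λ v → q m (λ′ * v)) (modN-+ (b - b₃) b₃) ⟩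
    q m (λ′ * ((D + B₃) % N m))              ≡⟨ q-cong (≈N.%-*ʳ λ′ (D + B₃)) ⟩
    q m (λ′ * (D + B₃))                      ≡⟨ cong (q m) (distrib λ′ D B₃) ⟩
    q m (λ′ * B₃ + λ′ * D)                   ≡⟨ q-sum (λ′ * B₃) (λ′ * D) ⟩
    (q m (λ′ * B₃) + q m (λ′ * D) + carry (λ′ * B₃) (λ′ * D)) % 7 ∎
    where
      open ≡-Reasoning
      D = modN m (b - b₃)
      split : ∀ a b → a ≡ (a - b) ℤ.+ b
      split = solve-∀
      distrib : ∀ l d e → l * (d + e) ≡ l * e + l * d
      distrib l d e = trans (*-distribˡ-+ l d e) (+-comm (l * d) (l * e))

  ℓ·-digits : ∀ λ′ → ℓ· m λ′ (b₁ ∷ b₂ ∷ b₃ ∷ []) ≡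
    ℓ₃ ((q m (λ′ * B₃) + q m (λ′ * X) + carry (λ′ * B₃) (λ′ * X)) % 7)
       ((q m (λ′ * B₃) + q m (λ′ * Y) + carry (λ′ * B₃) (λ′ * Y)) % 7)
       (q m (λ′ * B₃))
  ℓ·-digits λ′ = cong₃ ℓ₃ (q-·-shifted λ′ b₁) (q-·-shifted λ′ b₂) (q-· λ′ b₃)
    where
      cong₃ : ∀ (f : ℕ → ℕ → ℕ → ℕ) {a a′ b b′ c c′} → a ≡ a′ → b ≡ b′ → c ≡ c′ → f a b c ≡ f a′ b′ c′
      cong₃ f refl refl refl = refl

  window-bound : ∀ λ′ {L o d₁ d₂} → T (spread≤ L o d₁ d₂)
    → q m (λ′ * X) ≈₇.≈ d₁ → q m (λ′ * Y) ≈₇.≈ d₂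
    → (∀ E → T (admits o (carry E (λ′ * X)) (carry E (λ′ * Y))))
    → ℓ· m λ′ (b₁ ∷ b₂ ∷ b₃ ∷ []) ≤ L
  window-bound λ′ {L} {o} {d₁} {d₂} table qX≈ qY≈ admissible = subst (_≤ L) (sym (ℓ·-digits λ′))
    (subst₂ (λ u v → ℓ₃ u v e ≤ L) (sym (shift {X} qX≈)) (sym (shift {Y} qY≈))
      (spread≤-sound {L} {o} {d₁} {d₂} {e} table (q<7 E) (carry≤1 E (λ′ * X)) (carry≤1 E (λ′ * Y)) (admissible E)))
    where
      E = λ′ * B₃
      e = q m E
      shift : ∀ {Z d} → q m (λ′ * Z) ≈₇.≈ d
        → (e + q m (λ′ * Z) + carry E (λ′ * Z)) % 7 ≡ (e + d + carry E (λ′ * Z)) % 7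
      shift {Z} {d} qZ≈ = ≈₇.≈-+ʳ (carry E (λ′ * Z)) {e + q m (λ′ * Z)} {e + d} (≈₇.≈-+ˡ e qZ≈)

-- Part (i): if ν(x) ≠ ν(y), a multiplier sends both x and y to residues ≤ P,
-- so that every λbᵢ has digit q(λb₃) plus a digit-and-carry of at most 1.
module PartOne (m : ℕ) where
  open import Defs using (N; q; ℓ·; Multiplier)
  open import Data.Nat
  open import Data.Nat.Properties
  open import Data.Nat.DivMod
  open import Data.Nat.Tactic.RingSolver using (solve-∀)
  open import Data.Bool using (T)
  open import Data.List using (_∷_; [])
  open import Data.Product using (Σ; _×_; _,_)
  open import Data.Sum using (inj₁; inj₂)
  open import Relation.Binary.PropositionalEquality
  open import Relation.Nullary using (yes; no)
  open Digits m
  open Units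
  open Windows

  private
    module ≈N = Congruence (N m)
    open ≈N using (_≈_)

  ≡1⇒≈1 : ∀ {a} → a % N m ≡ 1 → a ≈ 1
  ≡1⇒≈1 a≡1 = trans a≡1 (sym (m<n⇒m%n≡m 1<N))

  pow-vanishes : ∀ {k} → m < k → 7 ^ k ≡ 7 ^ (k ∸ suc m) * N m
  pow-vanishes {k} m<k = trans (cong (7 ^_) (sym (trans (+-comm (k ∸ suc m) (suc m)) (m+[n∸m]≡n m<k))))
                               (^-distribˡ-+-* 7 (k ∸ suc m) (suc m))

  pow-small : ∀ k → (7 ^ k) % N m ≤ P
  pow-small k with k ≤? m
  ... | yes k≤m = subst (_≤ P) (sym (m<n⇒m%n≡m (^-monoʳ-< 7 (s≤s (s≤s z≤n)) (s≤s k≤m)))) (^-monoʳ-≤ 7 k≤m)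
  ... | no  k≰m = subst (_≤ P) (sym (trans (cong (_% N m) (pow-vanishes (≰⇒> k≰m))) (m*n%n≡0 (7 ^ (k ∸ suc m)) (N m)))) z≤n

  digit+carry≤1 : ∀ E A → A % N m ≤ P → q m A + carry E A ≤ 1
  digit+carry≤1 E A A≤P with m≤n⇒m<n∨m≡n A≤P
  ... | inj₁ A<P = subst (_≤ 1) (cong (_+ carry E A) (sym q≡0)) (carry≤1 E A)
    where
      q≡0 : q m A ≡ 0
      q≡0 = trans (sym (q-%N A)) (cong (_% 7) (m<n⇒m/n≡0 A<P))
  ... | inj₂ A≡P = ≤-reflexive (cong₂ _+_ q≡1 carry≡0)
    where
      q≡1 : q m A ≡ 1
      q≡1 = trans (sym (q-%N A)) (trans (cong (q m) A≡P) (cong (_% 7) (n/n≡1 P)))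
      carry≡0 : carry E A ≡ 0
      carry≡0 = begin
        carry E A               ≡⟨ carry-cong E (sym (m%n%n≡m%n A (N m))) ⟩
        (E % P + A % N m % P) / P ≡⟨ cong (λ v → (E % P + v % P) / P) A≡P ⟩
        (E % P + P % P) / P     ≡⟨ cong (λ v → (E % P + v) / P) (n%n≡0 P) ⟩
        (E % P + 0) / P         ≡⟨ cong (_/ P) (+-identityʳ (E % P)) ⟩
        E % P / P               ≡⟨ m<n⇒m/n≡0 (m%n<n E P) ⟩
        0                       ∎
        where open ≡-Reasoning

  small-window : ∀ b₁ b₂ b₃ λ′ → (λ′ * Shape.X m b₁ b₂ b₃) % N m ≤ P → (λ′ * Shape.Y m b₁ b₂ b₃) % N m ≤ P
    → ℓ· m λ′ (b₁ ∷ b₂ ∷ b₃ ∷ []) ≤ 2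
  small-window b₁ b₂ b₃ λ′ X≤P Y≤P = subst (_≤ 2) (sym (ℓ·-digits λ′))
    (subst₂ (λ u v → ℓ₃ (u % 7) (v % 7) e ≤ 2) (sym (regroup (λ′ * X))) (sym (regroup (λ′ * Y)))
      (spread≤-sound {2} {unordered} {0} {0} table (q<7 E)
        (digit+carry≤1 E (λ′ * X) X≤P) (digit+carry≤1 E (λ′ * Y) Y≤P) _))
    where
      open Shape m b₁ b₂ b₃
      E = λ′ * B₃
      e = q m E
      table : T (spread≤ 2 unordered 0 0)
      table = _
      regroup : ∀ A → e + q m A + carry E A ≡ e + 0 + (q m A + carry E A)
      regroup A = trans (+-assoc e (q m A) (carry E A)) (cong (_+ (q m A + carry E A)) (sym (+-identityʳ e)))

  SmallImages : ℕ → ℕ → Set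
  SmallImages X Y = Σ ℕ (λ λ′ → Multiplier m λ′ × (λ′ * X) % N m ≤ P × (λ′ * Y) % N m ≤ P)

  module Images {X Y Ua Ub a b λ₀ : ℕ} (a<b : a < b) (Ub≢0 : Ub % 7 ≢ 0)
           (X≡ : X ≡ (Ua * 7 ^ a) % N m) (Y≡ : Y ≡ (Ub * 7 ^ b) % N m)
           (Uaλ₀≡1 : (Ua * λ₀) % N m ≡ 1) where

    X≈ : X ≈ Ua * 7 ^ a
    X≈ = trans (cong (_% N m) X≡) (m%n%n≡m%n _ (N m))

    Y≈ : Y ≈ Ub * 7 ^ b
    Y≈ = trans (cong (_% N m) Y≡) (m%n%n≡m%n _ (N m))

    λ₀-unit : λ₀ % 7 ≢ 0
    λ₀-unit = inverse-unit m Ua λ₀ Uaλ₀≡1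

    scaled-X : ∀ k → (λ₀ * k) % N m * X ≈ k * 7 ^ a
    scaled-X k = begin
      (λ₀ * k) % N m * X        ≈⟨ ≈N.≈-* (≈N.%-≈ (λ₀ * k)) X≈ ⟩
      λ₀ * k * (Ua * 7 ^ a)     ≡⟨ regroup λ₀ k Ua (7 ^ a) ⟩
      (Ua * λ₀) * (k * 7 ^ a)   ≈⟨ ≈N.≈-*ʳ (k * 7 ^ a) (≡1⇒≈1 Uaλ₀≡1) ⟩
      1 * (k * 7 ^ a)           ≡⟨ *-identityˡ (k * 7 ^ a) ⟩
      k * 7 ^ a                 ∎
      where
        open ≈N.≈-Reasoning
        regroup : ∀ x k y z → x * k * (y * z) ≡ (y * x) * (k * z)
        regroup = solve-∀

    -- b > m: λ₀ sends X to 7^a and Y to 0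
    small-images-high : m < b → SmallImages X Y
    small-images-high m<b = λ′ , unit-multiplier m λ′ (m%n<n (λ₀ * 1) (N m)) λ′-unit , X-small , Y-small
      where
        λ′ = (λ₀ * 1) % N m
        λ′-unit : λ′ % 7 ≢ 0
        λ′-unit = subst (_≢ 0) (sym (%7^-%7 m (λ₀ * 1))) (subst (λ v → v % 7 ≢ 0) (sym (*-identityʳ λ₀)) λ₀-unit)
        X-small : (λ′ * X) % N m ≤ P
        X-small = subst (_≤ P) (sym (trans (scaled-X 1) (cong (_% N m) (*-identityˡ (7 ^ a))))) (pow-small a)
        Y≈0 : λ′ * Y ≈ 0
        Y≈0 = begin
          λ′ * Y                                 ≈⟨ ≈N.≈-* (≈N.%-≈ (λ₀ * 1)) Y≈ ⟩
          λ₀ * 1 * (Ub * 7 ^ b)                  ≡⟨ cong (λ v → λ₀ * 1 * (Ub * v)) (pow-vanishes m<b) ⟩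
          λ₀ * 1 * (Ub * (7 ^ j * N m))          ≡⟨ regroup λ₀ Ub (7 ^ j) (N m) ⟩
          0 + (λ₀ * Ub * 7 ^ j) * N m            ≈⟨ ≈N.+-multiple-≈ 0 (λ₀ * Ub * 7 ^ j) ⟩
          0                                      ∎
          where
            open ≈N.≈-Reasoning
            j = b ∸ suc m
            regroup : ∀ x y z n → x * 1 * (y * (z * n)) ≡ 0 + (x * y * z) * n
            regroup = solve-∀
        Y-small : (λ′ * Y) % N m ≤ P
        Y-small = subst (_≤ P) (sym (trans Y≈0 (m<n⇒m%n≡m (<-trans (s≤s z≤n) 1<N)))) z≤n

    scaled-Y : b ≤ m → ∀ k → (Ub * λ₀ * k) %7^ suc (m ∸ b) ≡ 1 → (λ₀ * k) % N m * Y ≈ 7 ^ b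
    scaled-Y b≤m k wk≡1 = begin
      (λ₀ * k) % N m * Y         ≈⟨ ≈N.≈-* (≈N.%-≈ (λ₀ * k)) Y≈ ⟩
      λ₀ * k * (Ub * 7 ^ b)      ≡⟨ regroup λ₀ k Ub (7 ^ b) ⟩
      (Ub * λ₀ * k) * 7 ^ b      ≡⟨ cong (_* 7 ^ b) (trans (m≡m%n+[m/n]*n (Ub * λ₀ * k) Q) (cong (_+ t * Q) wk≡1)) ⟩
      (1 + t * Q) * 7 ^ b        ≡⟨ expand t Q (7 ^ b) ⟩
      7 ^ b + t * (Q * 7 ^ b)    ≡⟨ cong (λ v → 7 ^ b + t * v) Q7^b≡N ⟩
      7 ^ b + t * N m            ≈⟨ ≈N.+-multiple-≈ (7 ^ b) t ⟩
      7 ^ b                      ∎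
      where
        open ≈N.≈-Reasoning
        Q = 7 ^ suc (m ∸ b)
        instance
          Q≢0 : NonZero Q
          Q≢0 = m^n≢0 7 (suc (m ∸ b))
        t = (Ub * λ₀ * k) / Q
        Q7^b≡N : Q * 7 ^ b ≡ N m
        Q7^b≡N = trans (sym (^-distribˡ-+-* 7 (suc (m ∸ b)) b)) (cong (λ v → 7 ^ suc v) (m∸n+n≡m b≤m))
        regroup : ∀ x k y z → x * k * (y * z) ≡ (y * x * k) * z
        regroup = solve-∀
        expand : ∀ t Q z → (1 + t * Q) * z ≡ z + t * (Q * z)
        expand = solve-∀

    -- b ≤ m: with such a k reduced modulo Q, λ₀k sends Y to 7^b and X to
    -- k·7^a < Q·7^a ≤ P
    small-images-low : b ≤ m → ∀ k → (Ub * λ₀ * k) %7^ suc (m ∸ b) ≡ 1 → SmallImages X Y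
    small-images-low b≤m k wk≡1 = λ′ , unit-multiplier m λ′ (m%n<n (λ₀ * k′) (N m)) λ′-unit , X-small , Y-small
      where
        e = m ∸ b
        Q = 7 ^ suc e
        instance
          Q≢0 : NonZero Q
          Q≢0 = m^n≢0 7 (suc e)
        k′ = k % Q
        wk′≡1 : (Ub * λ₀ * k′) % Q ≡ 1
        wk′≡1 = trans (Congruence.%-*ʳ Q (Ub * λ₀) k) wk≡1
        λ′ = (λ₀ * k′) % N m
        λ′-unit : λ′ % 7 ≢ 0
        λ′-unit = subst (_≢ 0) (sym (%7^-%7 m (λ₀ * k′))) (unit-* λ₀ k′ λ₀-unit (inverse-unit e (Ub * λ₀) k′ wk′≡1))
        k′7^a<P : k′ * 7 ^ a < P
        k′7^a<P = begin-strict
          k′ * 7 ^ a        <⟨ *-monoˡ-< (7 ^ a) {{m^n≢0 7 a}} (m%n<n k Q) ⟩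
          Q * 7 ^ a         ≡⟨ ^-distribˡ-+-* 7 (suc e) a ⟨
          7 ^ (suc e + a)   ≤⟨ ^-monoʳ-≤ 7 (subst (suc e + a ≤_) (m∸n+n≡m b≤m) (subst (_≤ e + b) (+-suc e a) (+-monoʳ-≤ e a<b))) ⟩
          P                 ∎
          where open ≤-Reasoning
        X-small : (λ′ * X) % N m ≤ P
        X-small = subst (_≤ P) (sym (trans (scaled-X k′) (m<n⇒m%n≡m (<-trans k′7^a<P P<N)))) (<⇒≤ k′7^a<P)
        Y-small : (λ′ * Y) % N m ≤ P
        Y-small = subst (_≤ P) (sym (trans (scaled-Y b≤m k′ wk′≡1) (m<n⇒m%n≡m (^-monoʳ-< 7 (s≤s (s≤s z≤n)) (s≤s b≤m)))))
                    (^-monoʳ-≤ 7 b≤m)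

  small-images : ∀ {X Y Ua Ub a b} → a < b → Ua % 7 ≢ 0 → Ub % 7 ≢ 0
    → X ≡ (Ua * 7 ^ a) % N m → Y ≡ (Ub * 7 ^ b) % N m → SmallImages X Y
  small-images {Ua = Ua} {Ub} {b = b} a<b Ua≢0 Ub≢0 X≡ Y≡ with inverse m Ua Ua≢0
  ... | λ₀ , Uaλ₀≡1 with b ≤? m
  ...   | no  b≰m = small-images-high (≰⇒> b≰m)
    where open Images {Ua = Ua} {Ub} {λ₀ = λ₀} a<b Ub≢0 X≡ Y≡ Uaλ₀≡1
  ...   | yes b≤m = let k , wk≡1 = inverse (m ∸ b) (Ub * λ₀) (unit-* Ub λ₀ Ub≢0 λ₀-unit)
                    in small-images-low b≤m k wk≡1
    where open Images {Ua = Ua} {Ub} {λ₀ = λ₀} a<b Ub≢0 X≡ Y≡ Uaλ₀≡1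

-- Bookkeeping for x, y of the same valuation h < m: with P′ = 7^(m−h),
-- residues U·7^h are scaled by multiples of P′ into multiples of P = 7^m.
module Levels (m h : ℕ) (h<m : h < m) where
  open import Defs using (N; q)
  open import Data.Nat
  open import Data.Nat.Properties
  open import Data.Nat.DivMod
  open import Relation.Binary.PropositionalEquality
  open Digits m

  P′ : ℕ
  P′ = 7 ^ (m ∸ h)

  instance
    P′≢0 : NonZero P′
    P′≢0 = m^n≢0 7 (m ∸ h)
    7P′≢0 : NonZero (7 * P′)
    7P′≢0 = m^n≢0 7 (suc (m ∸ h))

  1≤m∸h : 1 ≤ m ∸ h
  1≤m∸h = m<n⇒0<n∸m h<m

  7≤P′ : 7 ≤ P′
  7≤P′ = ^-monoʳ-≤ 7 1≤m∸h

  P′*7^h≡P : P′ * 7 ^ h ≡ P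
  P′*7^h≡P = trans (sym (^-distribˡ-+-* 7 (m ∸ h) h)) (cong (7 ^_) (m∸n+n≡m (<⇒≤ h<m)))

  7P′*7^h≡N : 7 * P′ * 7 ^ h ≡ N m
  7P′*7^h≡N = trans (*-assoc 7 P′ (7 ^ h)) (cong (7 *_) P′*7^h≡P)

  P′%7≡0 : P′ % 7 ≡ 0
  P′%7≡0 with m ∸ h | 1≤m∸h
  ... | suc t | _ = trans (cong (_% 7) (*-comm 7 (7 ^ t))) (m*n%n≡0 (7 ^ t) 7)

  level-small : ∀ {l} → l < P′ → l * 7 ^ h < P
  level-small {l} l<P′ = subst (l * 7 ^ h <_) P′*7^h≡P (*-monoˡ-< (7 ^ h) {{m^n≢0 7 h}} l<P′)

  q-level : ∀ {l} d → l < P′ → q m (l * 7 ^ h + d * P) ≡ d % 7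
  q-level {l} d l<P′ = trans (q-shift (l * 7 ^ h) d) (cong (λ v → (v + d) % 7) (cong (_% 7) (m<n⇒m/n≡0 (level-small l<P′))))

  low-level : ∀ {l} d → l < P′ → (l * 7 ^ h + d * P) % P ≡ l * 7 ^ h
  low-level {l} d l<P′ = trans ([m+kn]%n≡m%n (l * 7 ^ h) d P) (m<n⇒m%n≡m (level-small l<P′))

-- Normalise x to
-- 7^h by λ₀ = u_x⁻¹; then y becomes z·7^h with z ≡ 2 (mod 7).  The
-- multiplier λ₀(a + 7^(m−h)k) sends x to a·7^h + kP and y to l·7^h + (c+kz)P,
-- where a z ≡ cP′ + l (mod 7P′), P′ = 7^(m−h).  The approximation lemma
-- provides a ∈ [1,6] with c ∈ {0,1}, or c = 6 and a ≤ l; then k ∈ {0,6}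
-- gives leading digits (0,0), (6,6) or (0,6), the last with ordered carries.
module CaseTwo (m h : ℕ) (h<m : h < m) (b₁ b₂ b₃ : ℤ) where
  open import Defs using (N; q; ℓ·; Multiplier; _·[_]_)
  open import Data.Nat
  open import Data.Nat.Properties
  open import Data.Nat.DivMod
  open import Data.Nat.Tactic.RingSolver using (solve-∀)
  open import Data.Bool using (T)
  open import Data.Integer as ℤ using (_-_)
  open import Data.List using (_∷_; [])
  open import Data.Product using (Σ; _×_; _,_)
  open import Data.Sum using (_⊎_; inj₁; inj₂)
  open import Relation.Binary.PropositionalEquality
  open Digits m
  open Units
  open Windows
  open Levels m h h<m
  open Shape m b₁ b₂ b₃

  private
    module ≈₇ = Congruence 7
    module ≈N = Congruence (N m)

  Outcome : Set
  Outcome = Σ ℕ (λ λ′ → Multiplier m λ′ × GoodDigit (q m (λ′ ·[ m ] (b₂ - b₃)))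
                       × ℓ· m λ′ (b₁ ∷ b₂ ∷ b₃ ∷ []) ≤ 2)

  module Scaled {Ux Uy λ₀ : ℕ} (X≡ : X ≡ (Ux * 7 ^ h) % N m) (Y≡ : Y ≡ (Uy * 7 ^ h) % N m)
                (Uxλ₀≡1 : (Ux * λ₀) % N m ≡ 1) where

    -- y/x modulo 7P′
    z : ℕ
    z = (λ₀ * Uy) % (7 * P′)

    module _ (a k c l : ℕ) (az≡ : (a * z) % (7 * P′) ≡ c * P′ + l) (l<P′ : l < P′) (a≤6 : a ≤ 6) where

      w = a + P′ * k
      λw = (λ₀ * w) % N m

      λX≈ : λw * X ≈N.≈ a * 7 ^ h + k * P
      λX≈ = begin
        λw * X                       ≈⟨ ≈N.≈-* (≈N.%-≈ (λ₀ * w)) X≈ ⟩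
        λ₀ * w * (Ux * 7 ^ h)        ≡⟨ regroup λ₀ w Ux (7 ^ h) ⟩
        (Ux * λ₀) * (w * 7 ^ h)      ≈⟨ ≈N.≈-*ʳ (w * 7 ^ h) (trans Uxλ₀≡1 (sym (m<n⇒m%n≡m 1<N))) ⟩
        1 * (w * 7 ^ h)              ≡⟨ expand a P′ k (7 ^ h) ⟩
        a * 7 ^ h + k * (P′ * 7 ^ h) ≡⟨ cong (λ v → a * 7 ^ h + k * v) P′*7^h≡P ⟩
        a * 7 ^ h + k * P            ∎
        where
          open ≈N.≈-Reasoning
          X≈ : X ≈N.≈ Ux * 7 ^ h
          X≈ = trans (cong (_% N m) X≡) (m%n%n≡m%n _ (N m))
          regroup : ∀ x w u p → x * w * (u * p) ≡ (u * x) * (w * p)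
          regroup = solve-∀
          expand : ∀ a P′ k p → 1 * ((a + P′ * k) * p) ≡ a * p + k * (P′ * p)
          expand = solve-∀

      λY≈ : λw * Y ≈N.≈ l * 7 ^ h + (c + k * z) * P
      λY≈ = begin
        λw * Y                                            ≈⟨ ≈N.≈-* (≈N.%-≈ (λ₀ * w)) Y≈ ⟩
        λ₀ * w * (Uy * 7 ^ h)                             ≡⟨ regroup λ₀ w Uy (7 ^ h) ⟩
        w * (λ₀ * Uy) * 7 ^ h                             ≡⟨ cong (λ v → w * v * 7 ^ h) (m≡m%n+[m/n]*n (λ₀ * Uy) (7 * P′)) ⟩
        w * (z + t * (7 * P′)) * 7 ^ h                    ≡⟨ split-t w z t (7 * P′) (7 ^ h) ⟩
        w * z * 7 ^ h + (w * t) * (7 * P′ * 7 ^ h)        ≡⟨ cong (λ v → w * z * 7 ^ h + (w * t) * v) 7P′*7^h≡N ⟩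
        w * z * 7 ^ h + (w * t) * N m                     ≈⟨ ≈N.+-multiple-≈ (w * z * 7 ^ h) (w * t) ⟩
        w * z * 7 ^ h                                     ≡⟨ split-w a P′ k z (7 ^ h) ⟩
        (a * z) * 7 ^ h + k * z * (P′ * 7 ^ h)            ≡⟨ cong₂ (λ u v → u * 7 ^ h + k * z * v) az≡′ P′*7^h≡P ⟩
        (c * P′ + l + s * (7 * P′)) * 7 ^ h + k * z * P   ≡⟨ split-s c P′ l s (7 ^ h) (k * z * P) ⟩
        (c * (P′ * 7 ^ h) + l * 7 ^ h + k * z * P) + s * (7 * P′ * 7 ^ h)
                                                          ≡⟨ cong₂ (λ u v → (c * u + l * 7 ^ h + k * z * P) + s * v) P′*7^h≡P 7P′*7^h≡N ⟩
        (c * P + l * 7 ^ h + k * z * P) + s * N m         ≈⟨ ≈N.+-multiple-≈ (c * P + l * 7 ^ h + k * z * P) s ⟩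
        c * P + l * 7 ^ h + k * z * P                     ≡⟨ collect c P l (7 ^ h) k z ⟩
        l * 7 ^ h + (c + k * z) * P                       ∎
        where
          open ≈N.≈-Reasoning
          Y≈ : Y ≈N.≈ Uy * 7 ^ h
          Y≈ = trans (cong (_% N m) Y≡) (m%n%n≡m%n _ (N m))
          t = (λ₀ * Uy) / (7 * P′)
          s = (a * z) / (7 * P′)
          az≡′ : a * z ≡ c * P′ + l + s * (7 * P′)
          az≡′ = trans (m≡m%n+[m/n]*n (a * z) (7 * P′)) (cong (_+ s * (7 * P′)) az≡)
          regroup : ∀ x w u p → x * w * (u * p) ≡ w * (x * u) * p
          regroup = solve-∀
          split-t : ∀ w z t M p → w * (z + t * M) * p ≡ w * z * p + (w * t) * (M * p)
          split-t = solve-∀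
          split-w : ∀ a P′ k z p → (a + P′ * k) * z * p ≡ (a * z) * p + k * z * (P′ * p)
          split-w = solve-∀
          split-s : ∀ c P′ l s p r → (c * P′ + l + s * (7 * P′)) * p + r
                                   ≡ (c * (P′ * p) + l * p + r) + s * (7 * P′ * p)
          split-s = solve-∀
          collect : ∀ c P l p k z → c * P + l * p + k * z * P ≡ l * p + (c + k * z) * P
          collect = solve-∀

      q-λX : q m (λw * X) ≡ k % 7
      q-λX = trans (q-cong λX≈) (q-level k (<-≤-trans (s≤s a≤6) 7≤P′))

      low-λX : (λw * X) % P ≡ a * 7 ^ h
      low-λX = trans (low-cong λX≈) (low-level k (<-≤-trans (s≤s a≤6) 7≤P′))

      q-λY : q m (λw * Y) ≡ (c + k * z) % 7
      q-λY = trans (q-cong λY≈) (q-level (c + k * z) l<P′)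

      low-λY : (λw * Y) % P ≡ l * 7 ^ h
      low-λY = trans (low-cong λY≈) (low-level (c + k * z) l<P′)

      outcome : 1 ≤ a → ∀ {o d₂} → T (spread≤ 2 o k d₂) → (c + k * z) % 7 ≡ d₂ → GoodDigit d₂
        → (∀ E → T (admits o (carry E (λw * X)) (carry E (λw * Y)))) → Outcome
      outcome 1≤a {o} {d₂} table d₂≡ good admissible =
        λw , unit-multiplier m λw (m%n<n (λ₀ * w) (N m)) λw-unit , good′ , window
        where
          λ₀-unit : λ₀ % 7 ≢ 0
          λ₀-unit = inverse-unit m Ux λ₀ Uxλ₀≡1
          w≡a : w % 7 ≡ a
          w≡a = trans (≈₇.≈-+ˡ a {P′ * k} {0 * k} (≈₇.≈-*ʳ k {P′} {0} P′%7≡0))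
                      (trans (cong (_% 7) (+-identityʳ a)) (m<n⇒m%n≡m (s≤s a≤6)))
          λw-unit : λw % 7 ≢ 0
          λw-unit = subst (_≢ 0) (sym (%7^-%7 m (λ₀ * w)))
                      (unit-* λ₀ w λ₀-unit (λ w≡0 → <⇒≢ 1≤a (sym (trans (sym w≡a) w≡0))))
          qY≡ : q m (λw * Y) ≡ d₂
          qY≡ = trans q-λY d₂≡
          good′ : GoodDigit (q m (λw ·[ m ] (b₂ - b₃)))
          good′ = subst GoodDigit (sym (trans (q-· λw (b₂ - b₃)) qY≡)) good
          window : ℓ· m λw (b₁ ∷ b₂ ∷ b₃ ∷ []) ≤ 2
          window = window-bound λw {2} {o} {k} {d₂} table
            (trans (cong (_% 7) q-λX) (≈₇.%-≈ k)) (cong (_% 7) qY≡) admissible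

    module _ (Uy≡ : Uy % 7 ≡ (2 * (Ux % 7)) % 7) where

      z≡2 : z % 7 ≡ 2
      z≡2 = trans (%7^-%7 (m ∸ h) (λ₀ * Uy)) (begin
        λ₀ * Uy           ≈⟨ ≈₇.≈-*ˡ λ₀ (trans Uy≡ (≈₇.%-*ʳ 2 Ux)) ⟩
        λ₀ * (2 * Ux)     ≡⟨ swap λ₀ Ux ⟩
        2 * (Ux * λ₀)     ≈⟨ ≈₇.≈-*ˡ 2 {Ux * λ₀} {1} (trans (sym (%7^-%7 m (Ux * λ₀))) (cong (_% 7) Uxλ₀≡1)) ⟩
        2                 ∎)
        where
          open ≈₇.≈-Reasoning
          swap : ∀ x u → x * (2 * u) ≡ 2 * (u * x)
          swap = solve-∀

      module _ (a l : ℕ) (l<P′ : l < P′) (1≤a : 1 ≤ a) (a≤6 : a ≤ 6) where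

        -- c = 0: k = 0 gives digits (0, 0)
        case-c0 : (a * z) % (7 * P′) ≡ 0 * P′ + l → Outcome
        case-c0 az≡ = outcome a 0 0 l az≡ l<P′ a≤6 1≤a {unordered} {0} _ refl (inj₁ refl) (λ _ → _)

        -- c = 1: k = 6 gives digits (6, 1 + 6z) = (6, 6)
        case-c1 : (a * z) % (7 * P′) ≡ 1 * P′ + l → Outcome
        case-c1 az≡ = outcome a 6 1 l az≡ l<P′ a≤6 1≤a {unordered} {6} _ six (inj₂ (inj₂ refl)) (λ _ → _)
          where
            six : (1 + 6 * z) % 7 ≡ 6
            six = ≈₇.≈-+ˡ 1 {6 * z} {6 * 2} (≈₇.≈-*ˡ 6 {z} {2} z≡2)

        -- c = 6 and a ≤ l: k = 0 gives digits (0, 6), and the low part of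
        -- λx (a·7^h) is below that of λy (l·7^h), so the carries are ordered
        case-c6 : (a * z) % (7 * P′) ≡ 6 * P′ + l → a ≤ l → Outcome
        case-c6 az≡ a≤l = outcome a 0 6 l az≡ l<P′ a≤6 1≤a {ascending} {6} _ refl (inj₂ (inj₂ refl))
          (λ E → ≤⇒≤ᵇ (carry-mono E (subst₂ _≤_ (sym (low-λX a 0 6 l az≡ l<P′ a≤6)) (sym (low-λY a 0 6 l az≡ l<P′ a≤6))
                                                (*-monoˡ-≤ (7 ^ h) a≤l))))

      from-approximation : Σ ℕ (λ a → 1 ≤ a × a ≤ 6 × ((a * z) % (7 * P′) < 2 * P′ ⊎ 6 * P′ + a ≤ (a * z) % (7 * P′)))
        → Outcome
      from-approximation (a , 1≤a , a≤6 , position) = split position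
        where
          V = (a * z) % (7 * P′)
          c = V / P′
          l = V % P′
          l<P′ : l < P′
          l<P′ = m%n<n V P′
          V≡ : V ≡ c * P′ + l
          V≡ = trans (m≡m%n+[m/n]*n V P′) (+-comm l (c * P′))
          V≡[_] : ∀ {c′} → c ≡ c′ → V ≡ c′ * P′ + l
          V≡[ refl ] = V≡
          small-c : ∀ c′ → c ≡ c′ → c′ < 2 → Outcome
          small-c 0 c≡0 _ = case-c0 a l l<P′ 1≤a a≤6 V≡[ c≡0 ]
          small-c 1 c≡1 _ = case-c1 a l l<P′ 1≤a a≤6 V≡[ c≡1 ]
          small-c (suc (suc _)) _ (s≤s (s≤s ()))
          split : V < 2 * P′ ⊎ 6 * P′ + a ≤ V → Outcome
          split (inj₁ V<2P′) = small-c c refl (m<n*o⇒m/o<n V<2P′)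
          split (inj₂ high)  = case-c6 a l l<P′ 1≤a a≤6 V≡[ c≡6 ] a≤l
            where
              6≤c : 6 ≤ c
              6≤c = subst (_≤ c) (m*n/n≡m 6 P′) (/-monoˡ-≤ P′ (≤-trans (m≤m+n (6 * P′) a) high))
              c≡6 : c ≡ 6
              c≡6 = ≤-antisym (≤-pred (m<n*o⇒m/o<n (m%n<n (a * z) (7 * P′)))) 6≤c
              a≤l : a ≤ l
              a≤l = +-cancelˡ-≤ (6 * P′) a l (subst (6 * P′ + a ≤_) V≡[ c≡6 ] high)

  case-two : ∀ {Ux Uy} → X ≡ (Ux * 7 ^ h) % N m → Y ≡ (Uy * 7 ^ h) % N m
    → Ux % 7 ≢ 0 → Uy % 7 ≡ (2 * (Ux % 7)) % 7 → Outcome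
  case-two {Ux} {Uy} X≡ Y≡ Ux≢0 Uy≡ =
    let λ₀ , Uxλ₀≡1 = inverse m Ux Ux≢0
        open Scaled {Ux} {Uy} {λ₀} X≡ Y≡ Uxλ₀≡1
    in from-approximation Uy≡ (Approximation.short-multiple P′ (≤-trans (n≤1+n 6) 7≤P′) z)

-- The multipliers
-- λₖ = 1 + 7^(m−h)k ∈ Λ_h fix the low parts of x and y and add k·u_x,
-- k·u_y to their leading digits; a finite search over the leading digits,
-- r(x) and the order of the low parts finds a k that works.
module CaseThree (m h : ℕ) (h<m : h < m) (b₁ b₂ b₃ : ℤ) where
  open import Defs using (N; q; ℓ·; Multiplier; Λ; _·[_]_)
  open import Data.Nat
  open import Data.Nat.Properties
  open import Data.Nat.DivMod
  open import Data.Nat.Tactic.RingSolver using (solve-∀)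
  open import Data.Bool using (Bool; _∧_; _∨_; T)
  open import Data.Bool.Properties using (T-∧; T-∨)
  open import Data.Integer as ℤ using (_-_)
  open import Data.List using (_∷_; [])
  open import Data.Product using (Σ; _×_; _,_; proj₁; proj₂)
  open import Data.Sum using (_⊎_; inj₁; inj₂)
  open import Function.Bundles using (Equivalence)
  open import Relation.Binary.PropositionalEquality
  open import Relation.Nullary using (contradiction)
  open BoundedSearch
  open Digits m
  open Units using (unit-multiplier)
  open Windows
  open Levels m h h<m
  open Shape m b₁ b₂ b₃

  private
    module ≈₇ = Congruence 7
    module ≈N = Congruence (N m)

  good-digit? : ℕ → Bool
  good-digit? v = (v ≡ᵇ 0) ∨ (v ≡ᵇ 5) ∨ (v ≡ᵇ 6)

  good-digit-sound : ∀ v → T (good-digit? v) → GoodDigit v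
  good-digit-sound v t with Equivalence.to T-∨ t
  ... | inj₁ is0 = inj₁ (≡ᵇ⇒≡ v 0 is0)
  ... | inj₂ t′ with Equivalence.to T-∨ t′
  ...   | inj₁ is5 = inj₂ (inj₁ (≡ᵇ⇒≡ v 5 is5))
  ...   | inj₂ is6 = inj₂ (inj₂ (≡ᵇ⇒≡ v 6 is6))

  works : ℕ → ℕ → ℕ → CarryOrder → ℕ → Bool
  works qX qY ρ o k = good-digit? ((qY + k * ((3 * ρ) % 7)) % 7)
                    ∧ spread≤ 3 o (qX + k * ρ) (qY + k * ((3 * ρ) % 7))

  Choice : ℕ → ℕ → ℕ → CarryOrder → Set
  Choice qX qY ρ o = Σ ℕ (λ k → k < 7 × T (works qX qY ρ o k))

  both-orders : ℕ → ℕ → ℕ → Bool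
  both-orders qX qY ρ = (ρ ≡ᵇ 0) ∨ (Any< 7 (works qX qY ρ ascending) ∧ Any< 7 (works qX qY ρ descending))

  choices-table : T (All< 7 (λ qX → All< 7 (λ qY → All< 7 (both-orders qX qY))))
  choices-table = _

  choices : ∀ {qX qY ρ} → qX < 7 → qY < 7 → ρ < 7 → ρ ≢ 0
    → Choice qX qY ρ ascending × Choice qX qY ρ descending
  choices {qX} {qY} {ρ} qX<7 qY<7 ρ<7 ρ≢0 = from-entry (Equivalence.to T-∨ entry)
    where
      entry : T (both-orders qX qY ρ)
      entry = All<-sound 7 (both-orders qX qY)
                (All<-sound 7 (λ qY → All< 7 (both-orders qX qY))
                  (All<-sound 7 (λ qX → All< 7 (λ qY → All< 7 (both-orders qX qY))) choices-table qX<7) qY<7) ρ<7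
      from-entry : T (ρ ≡ᵇ 0) ⊎ T (Any< 7 (works qX qY ρ ascending) ∧ Any< 7 (works qX qY ρ descending))
        → Choice qX qY ρ ascending × Choice qX qY ρ descending
      from-entry (inj₁ ρ≡0) = contradiction (≡ᵇ⇒≡ ρ 0 ρ≡0) ρ≢0
      from-entry (inj₂ both) = Any<-sound 7 _ (proj₁ parts) , Any<-sound 7 _ (proj₂ parts)
        where parts = Equivalence.to T-∧ both

  λₖ : ℕ → ℕ
  λₖ k = 1 + P′ * k

  λₖ-in-Λ : ∀ k → k < 7 → Λ m h (λₖ k)
  λₖ-in-Λ k k<7 = k , k<7 , refl

  λₖ<N : ∀ k → k < 7 → λₖ k < N m
  λₖ<N k k<7 = begin-strict
    1 + P′ * k     ≤⟨ +-monoʳ-≤ 1 (*-mono-≤ (^-monoʳ-≤ 7 (m∸n≤m m h)) (≤-pred k<7)) ⟩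
    1 + P * 6      <⟨ +-monoˡ-< (P * 6) (<-≤-trans (s≤s (s≤s z≤n)) (^-monoʳ-≤ 7 (≤-trans 1≤m∸h (m∸n≤m m h)))) ⟩
    P + P * 6      ≡⟨ seven-P P ⟩
    N m            ∎
    where
      open ≤-Reasoning
      seven-P : ∀ P → P + P * 6 ≡ 7 * P
      seven-P = solve-∀

  λₖ-unit : ∀ k → λₖ k % 7 ≢ 0
  λₖ-unit k λₖ≡0 = 1≢0 (trans (sym (≈₇.≈-+ˡ 1 {P′ * k} {0 * k} (≈₇.≈-*ʳ k {P′} {0} P′%7≡0))) λₖ≡0)
    where
      1≢0 : 1 ≢ 0
      1≢0 ()

  module _ {Z U : ℕ} (Z≡ : Z ≡ (U * 7 ^ h) % N m) (k : ℕ) where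

    λₖ-action : λₖ k * Z ≈N.≈ Z + (k * U) * P
    λₖ-action = begin
      λₖ k * Z                       ≡⟨ expand P′ k Z ⟩
      Z + P′ * k * Z                 ≈⟨ ≈N.≈-+ˡ Z (≈N.≈-*ˡ (P′ * k) Z≈) ⟩
      Z + P′ * k * (U * 7 ^ h)       ≡⟨ cong (Z +_) (regroup P′ k U (7 ^ h)) ⟩
      Z + k * U * (P′ * 7 ^ h)       ≡⟨ cong (λ v → Z + k * U * v) P′*7^h≡P ⟩
      Z + k * U * P                  ∎
      where
        open ≈N.≈-Reasoning
        Z≈ : Z ≈N.≈ U * 7 ^ h
        Z≈ = trans (cong (_% N m) Z≡) (m%n%n≡m%n _ (N m))
        expand : ∀ p k Z → (1 + p * k) * Z ≡ Z + p * k * Z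
        expand = solve-∀
        regroup : ∀ p k U q → p * k * (U * q) ≡ k * U * (p * q)
        regroup = solve-∀

    q-λₖ : q m (λₖ k * Z) ≡ (q m Z + k * U) % 7
    q-λₖ = trans (q-cong λₖ-action) (q-shift Z (k * U))

    carry-λₖ : ∀ E → carry E (λₖ k * Z) ≡ carry E Z
    carry-λₖ E = cong (λ v → (E % P + v) / P) (trans (low-cong λₖ-action) ([m+kn]%n≡m%n Z (k * U) P))

  Outcome : Set
  Outcome = Σ ℕ (λ λ′ → Multiplier m λ′ × GoodDigit (q m (λ′ ·[ m ] (b₂ - b₃)))
                       × ℓ· m λ′ (b₁ ∷ b₂ ∷ b₃ ∷ []) ≤ 3 × Λ m h λ′)

  module _ {Ux Uy : ℕ} (X≡ : X ≡ (Ux * 7 ^ h) % N m) (Y≡ : Y ≡ (Uy * 7 ^ h) % N m)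
           (Ux≢0 : Ux % 7 ≢ 0) (Uy≡ : Uy % 7 ≡ (3 * (Ux % 7)) % 7) where

    private
      ρ = Ux % 7
      qX = q m X
      qY = q m Y
      u′ = (3 * ρ) % 7

    from-choice : ∀ {o} → (∀ E → T (admits o (carry E X) (carry E Y))) → Choice qX qY ρ o → Outcome
    from-choice {o} admissible (k , k<7 , t) =
      λₖ k , unit-multiplier m (λₖ k) (λₖ<N k k<7) (λₖ-unit k) , good , window , λₖ-in-Λ k k<7
      where
        parts = Equivalence.to T-∧ t
        qλX≈ : q m (λₖ k * X) ≈₇.≈ qX + k * ρ
        qλX≈ = trans (cong (_% 7) (q-λₖ X≡ k))
                 (trans (≈₇.%-≈ (qX + k * Ux)) (≈₇.≈-+ˡ qX {k * Ux} {k * ρ} (≈₇.≈-*ˡ k (sym (≈₇.%-≈ Ux)))))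
        qλY≡ : q m (λₖ k * Y) ≡ (qY + k * u′) % 7
        qλY≡ = trans (q-λₖ Y≡ k) (≈₇.≈-+ˡ qY {k * Uy} {k * u′} (≈₇.≈-*ˡ k (trans Uy≡ (sym (≈₇.%-≈ (3 * ρ))))))
        good : GoodDigit (q m (λₖ k ·[ m ] (b₂ - b₃)))
        good = subst GoodDigit (sym (trans (q-· (λₖ k) (b₂ - b₃)) qλY≡))
                     (good-digit-sound _ (proj₁ parts))
        window : ℓ· m (λₖ k) (b₁ ∷ b₂ ∷ b₃ ∷ []) ≤ 3
        window = window-bound (λₖ k) {3} {o} {qX + k * ρ} {qY + k * u′} (proj₂ parts) qλX≈
          (trans (cong (_% 7) qλY≡) (≈₇.%-≈ (qY + k * u′)))
          (λ E → subst₂ (λ c₁ c₂ → T (admits o c₁ c₂)) (sym (carry-λₖ {U = Ux} X≡ k E)) (sym (carry-λₖ {U = Uy} Y≡ k E)) (admissible E))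

    pick : Choice qX qY ρ ascending × Choice qX qY ρ descending → X % P ≤ Y % P ⊎ Y % P ≤ X % P → Outcome
    pick (asc , _)    (inj₁ X≤Y) = from-choice {ascending} (λ E → ≤⇒≤ᵇ (carry-mono E X≤Y)) asc
    pick (_   , desc) (inj₂ Y≤X) = from-choice {descending} (λ E → ≤⇒≤ᵇ (carry-mono E Y≤X)) desc

    case-three : Outcome
    case-three = pick (choices (q<7 X) (q<7 Y) (m%n<n Ux 7) Ux≢0) (≤-total (X % P) (Y % P))

module Conclusion (m : ℕ) (b₁ b₂ b₃ : ℤ) (b₁≢b₃ : b₁ ≢ b₃) (b₂≢b₃ : b₂ ≢ b₃) where
  open import Defs
  open import Data.Nat using (_≤_; _<_; _*_; _%_; _^_; suc; NonZero)
  open import Data.Nat.Properties using (<-cmp; m^n≢0)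
  open import Data.Integer using (_-_; 0ℤ)
  open import Data.Integer.Properties using (i-j≡0⇒i≡j)
  open import Data.List using (_∷_; [])
  open import Data.Product using (Σ; _×_; _,_; proj₁; proj₂)
  open import Data.Sum using (_⊎_; inj₁; inj₂)
  open import Relation.Binary.Definitions using (tri<; tri≈; tri>)
  open import Relation.Binary.PropositionalEquality using (_≡_; refl; sym; trans; cong; subst)
  open import Relation.Nullary using (¬_; contradiction)
  open Valuation using (unit-times-power; module Cofactor)

  x y : ℤ
  x = b₁ - b₃
  y = b₂ - b₃

  x≢0 : x ≢ 0ℤ
  x≢0 x≡0 = b₁≢b₃ (i-j≡0⇒i≡j b₁ b₃ x≡0)

  y≢0 : y ≢ 0ℤ
  y≢0 y≡0 = b₂≢b₃ (i-j≡0⇒i≡j b₂ b₃ y≡0)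

  instance
    N≢0 : NonZero (N m)
    N≢0 = m^n≢0 7 (suc m)

  Ux Uy : ℕ
  Ux = proj₁ (unit-times-power m x x≢0)
  Uy = proj₁ (unit-times-power m y y≢0)

  X≡ : modN m x ≡ (Ux * 7 ^ ν x) % N m
  X≡ = proj₁ (proj₂ (unit-times-power m x x≢0))

  Y≡ : modN m y ≡ (Uy * 7 ^ ν y) % N m
  Y≡ = proj₁ (proj₂ (unit-times-power m y y≢0))

  Ux≡r : Ux % 7 ≡ r x
  Ux≡r = proj₂ (proj₂ (unit-times-power m x x≢0))

  Uy≡r : Uy % 7 ≡ r y
  Uy≡r = proj₂ (proj₂ (unit-times-power m y y≢0))

  Ux-unit : Ux % 7 ≢ 0
  Ux-unit = subst (_≢ 0) (sym Ux≡r) (Cofactor.r≢0 x x≢0)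

  Uy-unit : Uy % 7 ≢ 0
  Uy-unit = subst (_≢ 0) (sym Uy≡r) (Cofactor.r≢0 y y≢0)

  at : ∀ {Z U k k′} → k ≡ k′ → Z ≡ (U * 7 ^ k) % N m → Z ≡ (U * 7 ^ k′) % N m
  at refl Z≡ = Z≡

  part-one : ¬ (ν x ≡ ν y) → Σ ℕ (λ λ' → Multiplier m λ' × ℓ· m λ' (b₁ ∷ b₂ ∷ b₃ ∷ []) ≤ 2)
  part-one νx≢νy with <-cmp (ν x) (ν y)
  ... | tri< νx<νy _ _ =
    let λ' , mult , X≤P , Y≤P = PartOne.small-images m {Ua = Ux} {Uy} νx<νy Ux-unit Uy-unit X≡ Y≡
    in λ' , mult , PartOne.small-window m b₁ b₂ b₃ λ' X≤P Y≤P
  ... | tri≈ _ νx≡νy _ = contradiction νx≡νy νx≢νy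
  ... | tri> _ _ νy<νx =
    let λ' , mult , Y≤P , X≤P = PartOne.small-images m {Ua = Uy} {Ux} νy<νx Uy-unit Ux-unit Y≡ X≡
    in λ' , mult , PartOne.small-window m b₁ b₂ b₃ λ' X≤P Y≤P

  ratio : ∀ j → r y ≡ (j * r x) % 7 → Uy % 7 ≡ (j * (Ux % 7)) % 7
  ratio j ry≡ = trans Uy≡r (trans ry≡ (cong (λ v → (j * v) % 7) (sym Ux≡r)))

  part-two : (h j : ℕ) → ν x ≡ h → ν y ≡ h → h < m → r y ≡ (j * r x) % 7 → (j ≡ 2 ⊎ j ≡ 3)
    → Σ ℕ (λ λ' → Multiplier m λ'
        × (q m (λ' ·[ m ] y) ≡ 0 ⊎ q m (λ' ·[ m ] y) ≡ 5 ⊎ q m (λ' ·[ m ] y) ≡ 6)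
        × ℓ· m λ' (b₁ ∷ b₂ ∷ b₃ ∷ []) ≤ j
        × (j ≡ 3 → Λ m h λ'))
  part-two h j νx≡h νy≡h h<m ry≡ (inj₁ refl) =
    let λ' , mult , good , window = CaseTwo.case-two m h h<m b₁ b₂ b₃ {Ux} {Uy}
                                      (at {U = Ux} νx≡h X≡) (at {U = Uy} νy≡h Y≡) Ux-unit (ratio 2 ry≡)
    in λ' , mult , good , window , λ ()
  part-two h j νx≡h νy≡h h<m ry≡ (inj₂ refl) =
    let λ' , mult , good , window , inΛ = CaseThree.case-three m h h<m b₁ b₂ b₃ {Ux} {Uy}
                                            (at {U = Ux} νx≡h X≡) (at {U = Uy} νy≡h Y≡) Ux-unit (ratio 3 ry≡)
    in λ' , mult , good , window , λ _ → inΛ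

open import Defs
open import Data.Nat using (ℕ; _≤_; _<_; _*_; _%_)
open import Data.Integer using (ℤ; _-_; 0ℤ)
open import Data.List using (_∷_; [])
open import Data.Product using (Σ; _×_; _,_)
open import Data.Sum using (_⊎_)
open import Relation.Binary.PropositionalEquality using (_≡_; _≢_)
open import Relation.Nullary using (¬_)

lemma6 : (m : ℕ) → 2 ≤ m → (b₁ b₂ b₃ : ℤ)
  → b₁ ≢ b₂ → b₁ ≢ b₃ → b₂ ≢ b₃
  → b₁ ≢ 0ℤ → b₂ ≢ 0ℤ → b₃ ≢ 0ℤ
  → ν b₁ ≡ 0 → ν b₂ ≡ 0 → ν b₃ ≡ 0
  → r b₁ ≡ r b₂ → r b₂ ≡ r b₃
  → (¬ (ν (b₁ - b₃) ≡ ν (b₂ - b₃))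
      → Σ ℕ (λ λ' → Multiplier m λ' × ℓ· m λ' (b₁ ∷ b₂ ∷ b₃ ∷ []) ≤ 2))
    × ((h j : ℕ) → ν (b₁ - b₃) ≡ h → ν (b₂ - b₃) ≡ h → h < m
      → r (b₂ - b₃) ≡ (j * r (b₁ - b₃)) % 7 → (j ≡ 2 ⊎ j ≡ 3)
      → Σ ℕ (λ λ' → Multiplier m λ'
          × (q m (λ' ·[ m ] (b₂ - b₃)) ≡ 0 ⊎ q m (λ' ·[ m ] (b₂ - b₃)) ≡ 5 ⊎ q m (λ' ·[ m ] (b₂ - b₃)) ≡ 6)
          × ℓ· m λ' (b₁ ∷ b₂ ∷ b₃ ∷ []) ≤ j
          × (j ≡ 3 → Λ m h λ')))
lemma6 m _ b₁ b₂ b₃ _ b₁≢b₃ b₂≢b₃ _ _ _ _ _ _ _ _ = part-one , part-two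
  where open Conclusion m b₁ b₂ b₃ b₁≢b₃ b₂≢b₃
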